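{- Let $P\subset V$ be a lattice polytope. Then there is a lattice polytope $P'\subset P$ with the same number of vertices as $P$ such that every lattice point (point of $\Lambda$) on the boundary of $P'$ is a vertex of $P'$.
   Context: $\Lambda$ is a rank-$2$ lattice (here $\Lambda=\mathbb Z^3/\mathbb Z(1,1,1)$) and $V=\Lambda\otimes_{\mathbb Z}\mathbb R$. A lattice polytope in $V$ is the convex hull of finitely many points of $\Lambda$; the boundary is taken relative to its affine hull.
   Formalization: Convex hulls, the containment $P'\subset P$, relative interiors and boundaries, and vertices are taken over points of $V$ with rational coordinates rather than over all real points of $V$. -}

module Defs where

open import Data.Nat using (ℕ; zero; suc)
open import Data.Fin using (Fin; zero; suc)
open import Data.Integer using (ℤ)
open import Data.Rational using (ℚ; _+_; _*_; _-_; 0ℚ; 1ℚ; _≤_; _<_; ∣_∣; _/_)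
open import Data.Product using (Σ; _×_; _,_; proj₁; proj₂; ∃)
open import Relation.Binary.PropositionalEquality using (_≡_)
open import Relation.Nullary using (¬_)

-- The rank-2 lattice Λ = ℤ³/ℤ(1,1,1) is identified with ℤ² via the basis
-- e₁ , e₂ (images of (1,0,0),(0,1,0)); V = Λ ⊗ ℝ ≅ ℝ².
-- Lattice points:
Lattice : Set
Lattice = ℤ × ℤ

-- Rational points of V (all lattice polytopes are rational polytopes).
Pt : Set
Pt = ℚ × ℚ

embed : Lattice → Pt
embed (a , b) = (a / 1 , b / 1)

_⊕_ : Pt → Pt → Pt
(a , b) ⊕ (c , d) = (a + c , b + d)

_·_ : ℚ → Pt → Pt
t · (a , b) = (t * a , t * b)

origin : Pt
origin = (0ℚ , 0ℚ)

sumℚ : {k : ℕ} → (Fin k → ℚ) → ℚ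
sumℚ {zero}  f = 0ℚ
sumℚ {suc k} f = f zero + sumℚ (λ i → f (suc i))

sumPt : {k : ℕ} → (Fin k → Pt) → Pt
sumPt {zero}  f = origin
sumPt {suc k} f = f zero ⊕ sumPt (λ i → f (suc i))

-- A lattice polytope is presented as the convex hull of finitely many
-- lattice points  v₀,…,v_{k-1}.
LatticePolytope : Set
LatticePolytope = Σ ℕ (λ k → Fin k → Lattice)

_∈conv_ : Pt → LatticePolytope → Set
x ∈conv (k , v) =
  Σ (Fin k → ℚ) λ λs →
    ((i : Fin k) → 0ℚ ≤ λs i) ×
    (sumℚ λs ≡ 1ℚ) ×
    (sumPt (λ i → λs i · embed (v i)) ≡ x)

_∈aff_ : Pt → LatticePolytope → Set
x ∈aff (k , v) =
  Σ (Fin k → ℚ) λ λs →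
    (sumℚ λs ≡ 1ℚ) ×
    (sumPt (λ i → λs i · embed (v i)) ≡ x)

_⊆P_ : LatticePolytope → LatticePolytope → Set
P' ⊆P P = (x : Pt) → x ∈conv P' → x ∈conv P

-- sup-norm distance (any norm gives the same topology)
dist∞< : Pt → Pt → ℚ → Set
dist∞< (a , b) (c , d) ε = (∣ a - c ∣ < ε) × (∣ b - d ∣ < ε)

RelInt : LatticePolytope → Pt → Set
RelInt P x =
  x ∈conv P ×
  Σ ℚ λ ε → (0ℚ < ε) ×
    ((y : Pt) → y ∈aff P → dist∞< x y ε → y ∈conv P)

OnBoundary : LatticePolytope → Pt → Set
OnBoundary P x = x ∈conv P × ¬ RelInt P x

IsVertex : LatticePolytope → Pt → Set
IsVertex P x =
  x ∈conv P ×
  ((p q : Pt) (t : ℚ) → p ∈conv P → q ∈conv P → 0ℚ < t → t < 1ℚ →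
     x ≡ (t · p) ⊕ ((1ℚ - t) · q) → p ≡ x)

HasVertexCount : LatticePolytope → ℕ → Set
HasVertexCount P n =
  Σ (Fin n → Pt) λ w →
    ((i : Fin n) → IsVertex P (w i)) ×
    ((i j : Fin n) → w i ≡ w j → i ≡ j) ×
    ((x : Pt) → IsVertex P x → ∃ λ i → w i ≡ x)

-- With at most one vertex there is nothing to do, and with two vertices A, B the segment
-- from A to A + (B - A) / gcd (B - A) works. With n ≥ 3 vertices, list them counterclockwise around
-- the lexicographically smallest one: this is a polygon in convex position inside P. Then treat the
-- vertices one at a time: a vertex B with neighbours A and C is replaced by a lattice point X of the
-- triangle A B C for which the edges A X and X C are primitive: starting from X = B, replace X by
-- A + (X - A) / g or C + (X - C) / g, where g > 1 is the gcd of that vector, until no such g is left;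
-- each step divides det A X C by g, so this ends.
-- The triangle lies in P, convex position is kept, and the edges made primitive earlier are
-- untouched. Finally, a lattice point on the boundary of the polygon lies on an edge, and the only
-- lattice points of a primitive edge are its endpoints.

module Submission where

open import Defs
open import Data.Nat as ℕ using (ℕ; zero; suc)
import Data.Nat.Properties as ℕP
open import Data.Integer as ℤ using (ℤ; +_; -[1+_])
  renaming (_+_ to _+ᶻ_; _*_ to _*ᶻ_; _-_ to _-ᶻ_; -_ to -ᶻ_; _≤_ to _≤ᶻ_; _<_ to _<ᶻ_)
import Data.Integer.Properties as ℤP
open import Data.Rational as ℚ using (ℚ; mkℚ; 0ℚ; 1ℚ; _+_; _*_; _-_; -_; _≤_; _<_; ∣_∣; _⊓_)
import Data.Rational.Properties as ℚP
import Data.Rational.Unnormalised as ℚᵘ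
import Data.Rational.Unnormalised.Properties as ℚᵘP
open import Data.Fin using (Fin; zero; suc; toℕ; fromℕ<; punchIn)
open import Data.Fin.Properties using (any?; toℕ-injective; toℕ<n; toℕ-fromℕ<; punchIn-injective; punchInᵢ≢i)
  renaming (_≟_ to _≟ᶠ_)
open import Data.Vec.Functional using (updateAt)
open import Data.Vec.Functional.Properties using (updateAt-updates; updateAt-minimal)
open import Data.Product using (Σ; ∃; _×_; _,_; proj₁; proj₂)
open import Data.Sum using (_⊎_; inj₁; inj₂; [_,_])
open import Data.Empty using (⊥; ⊥-elim)
open import Function using (const)
open import Relation.Nullary using (¬_; Dec; yes; no)
open import Relation.Binary.Definitions using (Tri; tri<; tri≈; tri>)
open import Relation.Binary.PropositionalEquality
  using (_≡_; _≢_; refl; sym; trans; cong; cong₂; subst; subst₂; module ≡-Reasoning)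
import Data.Integer.Solver as ZS
import Data.Rational.Solver as QS
open import Data.Nat.GCD as GCD using (gcd; gcd[m,n]∣m; gcd[m,n]∣n; gcd[m,n]≡0⇒m≡0; gcd[m,n]≡0⇒n≡0)
open import Data.Nat.Coprimality using (coprime-/gcd; coprime-Bézout)
open import Data.Nat.DivMod using (_/_; m/n*n≡m)
open import Data.Nat.Divisibility using () renaming (_∣_ to _∣ℕ_)
open import Data.List using (List; []; _∷_; length; tabulate)
open import Data.List.Properties using (length-tabulate)
open import Data.List.Relation.Unary.All using (All; []; _∷_)
import Data.List.Relation.Unary.All.Properties as All
open import Data.List.Relation.Unary.AllPairs using (AllPairs; []; _∷_)
import Data.List.Relation.Unary.AllPairs.Properties as AllPairs

module ZR = ZS.+-*-Solver
module QR = QS.+-*-Solver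

ι : ℤ → ℚ
ι a = a ℚ./ 1

module _ where
  open ℚᵘP using (≃-sym; ≃-trans)

  private
    ι-canonical : ∀ a → ℚ.toℚᵘ (ι a) ℚᵘ.≃ ℚᵘ.mkℚᵘ a 0
    ι-canonical a = ℚP.toℚᵘ-fromℚᵘ (ℚᵘ.mkℚᵘ a 0)

  ι-homo-+ : ∀ a b → ι (a +ᶻ b) ≡ ι a + ι b
  ι-homo-+ a b = ℚP.toℚᵘ-injective
    (≃-trans (ι-canonical (a +ᶻ b))
    (≃-trans (ℚᵘ.*≡* (ZR.solve 2 (λ x y → (x :+ y) :* con (+ 1) := (x :* con (+ 1) :+ y :* con (+ 1)) :* con (+ 1)) refl a b))
    (≃-trans (ℚᵘP.+-cong (≃-sym (ι-canonical a)) (≃-sym (ι-canonical b)))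
             (≃-sym (ℚP.toℚᵘ-homo-+ (ι a) (ι b))))))
    where open ZR

  ι-homo-* : ∀ a b → ι (a *ᶻ b) ≡ ι a * ι b
  ι-homo-* a b = ℚP.toℚᵘ-injective
    (≃-trans (ι-canonical (a *ᶻ b))
    (≃-trans (ℚᵘ.*≡* (ZR.solve 2 (λ x y → (x :* y) :* con (+ 1) := (x :* y) :* con (+ 1)) refl a b))
    (≃-trans (ℚᵘP.*-cong (≃-sym (ι-canonical a)) (≃-sym (ι-canonical b)))
             (≃-sym (ℚP.toℚᵘ-homo-* (ι a) (ι b))))))
    where open ZR

  ι-homo-neg : ∀ a → ι (-ᶻ a) ≡ - ι a
  ι-homo-neg a = ℚP.toℚᵘ-injective
    (≃-trans (ι-canonical (-ᶻ a))
    (≃-trans (ℚᵘ.*≡* refl)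
    (≃-trans (ℚᵘP.-‿cong (≃-sym (ι-canonical a)))
             (≃-sym (ℚP.toℚᵘ-homo‿- (ι a))))))

  ι-homo-sub : ∀ a b → ι (a -ᶻ b) ≡ ι a - ι b
  ι-homo-sub a b = trans (ι-homo-+ a (-ᶻ b)) (cong (λ t → ι a + t) (ι-homo-neg b))

  ι-mono-< : ∀ {a b} → a <ᶻ b → ι a < ι b
  ι-mono-< {a} {b} a<b = ℚP.toℚᵘ-cancel-<
    (ℚᵘP.<-respʳ-≃ (≃-sym (ι-canonical b)) (ℚᵘP.<-respˡ-≃ (≃-sym (ι-canonical a))
      (ℚᵘ.*<* (subst₂ _<ᶻ_ (sym (ℤP.*-identityʳ a)) (sym (ℤP.*-identityʳ b)) a<b))))

  ι-mono-≤ : ∀ {a b} → a ≤ᶻ b → ι a ≤ ι b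
  ι-mono-≤ {a} {b} a≤b = ℚP.toℚᵘ-cancel-≤
    (ℚᵘP.≤-respʳ-≃ (≃-sym (ι-canonical b)) (ℚᵘP.≤-respˡ-≃ (≃-sym (ι-canonical a))
      (ℚᵘ.*≤* (subst₂ _≤ᶻ_ (sym (ℤP.*-identityʳ a)) (sym (ℤP.*-identityʳ b)) a≤b))))

  ι-cancel-≤ : ∀ {a b} → ι a ≤ ι b → a ≤ᶻ b
  ι-cancel-≤ {a} {b} p = subst₂ _≤ᶻ_ (ℤP.*-identityʳ a) (ℤP.*-identityʳ b)
    (ℚᵘP.drop-*≤* (ℚᵘP.≤-respʳ-≃ (ι-canonical b) (ℚᵘP.≤-respˡ-≃ (ι-canonical a) (ℚP.toℚᵘ-mono-≤ p))))

ι-injective : ∀ {a b} → ι a ≡ ι b → a ≡ b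
ι-injective e = ℤP.≤-antisym (ι-cancel-≤ (ℚP.≤-reflexive e)) (ι-cancel-≤ (ℚP.≤-reflexive (sym e)))

embed-injective : ∀ {a b : Lattice} → embed a ≡ embed b → a ≡ b
embed-injective e = cong₂ _,_ (ι-injective (cong proj₁ e)) (ι-injective (cong proj₂ e))

*-pos : ∀ {a b} → 0ℚ < a → 0ℚ < b → 0ℚ < a * b
*-pos {a} {b} pa pb = ℚP.positive⁻¹ (a * b) {{ℚP.pos*pos⇒pos a {{ℚ.positive pa}} b {{ℚ.positive pb}}}}

*-nonNeg : ∀ {a b} → 0ℚ ≤ a → 0ℚ ≤ b → 0ℚ ≤ a * b
*-nonNeg {a} {b} pa pb =
  ℚP.nonNegative⁻¹ (a * b) {{ℚP.nonNeg*nonNeg⇒nonNeg a {{ℚ.nonNegative pa}} b {{ℚ.nonNegative pb}}}}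

+-nonNeg-≡0ˡ : ∀ {x y} → 0ℚ ≤ x → 0ℚ ≤ y → x + y ≡ 0ℚ → x ≡ 0ℚ
+-nonNeg-≡0ˡ {x} {y} px py e = ℚP.≤-antisym x≤0 px
  where
  open ℚP.≤-Reasoning
  x≤0 : x ≤ 0ℚ
  x≤0 = begin x ≡⟨ ℚP.+-identityʳ x ⟨ x + 0ℚ ≤⟨ ℚP.+-monoʳ-≤ x py ⟩ x + y ≡⟨ e ⟩ 0ℚ ∎

+-nonNeg-≡0ʳ : ∀ {x y} → 0ℚ ≤ x → 0ℚ ≤ y → x + y ≡ 0ℚ → y ≡ 0ℚ
+-nonNeg-≡0ʳ {x} {y} px py e = +-nonNeg-≡0ˡ py px (trans (ℚP.+-comm y x) e)

*-pos-≡0ˡ : ∀ {a b} → 0ℚ ≤ a → 0ℚ < b → a * b ≡ 0ℚ → a ≡ 0ℚ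
*-pos-≡0ˡ {a} {b} pa pb e with ℚP.<-cmp 0ℚ a
... | tri< lt _ _ = ⊥-elim (ℚP.<-irrefl (sym e) (*-pos lt pb))
... | tri≈ _ eq _ = sym eq
... | tri> _ _ gt = ⊥-elim (ℚP.<-irrefl refl (ℚP.<-≤-trans gt pa))

≤∧≢0⇒pos : ∀ {a} → 0ℚ ≤ a → a ≢ 0ℚ → 0ℚ < a
≤∧≢0⇒pos {a} le ne with ℚP.<-cmp 0ℚ a
... | tri< lt _ _ = lt
... | tri≈ _ e _ = ⊥-elim (ne (sym e))
... | tri> _ _ gt = ⊥-elim (ℚP.<-irrefl refl (ℚP.<-≤-trans gt le))

p<q⇒0<q-p : ∀ {p q} → p < q → 0ℚ < q - p
p<q⇒0<q-p {p} lt = ℚP.≤-<-trans (ℚP.≤-reflexive (sym (ℚP.+-inverseʳ p))) (ℚP.+-monoˡ-< (- p) lt)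

p≤q⇒0≤q-p : ∀ {p q} → p ≤ q → 0ℚ ≤ q - p
p≤q⇒0≤q-p {p} le = ℚP.≤-trans (ℚP.≤-reflexive (sym (ℚP.+-inverseʳ p))) (ℚP.+-monoˡ-≤ (- p) le)

0<q-p⇒p<q : ∀ {p q} → 0ℚ < q - p → p < q
0<q-p⇒p<q {p} {q} pos = ℚP.<-≤-trans (ℚP.≤-<-trans (ℚP.≤-reflexive (sym (ℚP.+-identityˡ p))) (ℚP.+-monoˡ-< p pos))
  (ℚP.≤-reflexive (QR.solve 2 (λ p q → (q :- p) :+ p := q) refl p q))
  where open QR

0≤q-p⇒p≤q : ∀ {p q} → 0ℚ ≤ q - p → p ≤ q
0≤q-p⇒p≤q {p} {q} nn = ℚP.≤-trans (ℚP.≤-trans (ℚP.≤-reflexive (sym (ℚP.+-identityˡ p))) (ℚP.+-monoˡ-≤ p nn))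
  (ℚP.≤-reflexive (QR.solve 2 (λ p q → (q :- p) :+ p := q) refl p q))
  where open QR

+≡⇒≡- : ∀ {a b c} → a + b ≡ c → b ≡ c - a
+≡⇒≡- {a} {b} e = trans (QR.solve 2 (λ a b → b := (a :+ b) :- a) refl a b) (cong (_- a) e)
  where open QR

*-posᶻ : ∀ {a b} → + 0 <ᶻ a → + 0 <ᶻ b → + 0 <ᶻ a *ᶻ b
*-posᶻ {a} {b} pa pb = subst (_<ᶻ a *ᶻ b) (ℤP.*-zeroʳ a) (ℤP.*-monoˡ-<-pos a {{ℤ.positive pa}} pb)

*-nonNegᶻ : ∀ {a b} → + 0 ≤ᶻ a → + 0 ≤ᶻ b → + 0 ≤ᶻ a *ᶻ b
*-nonNegᶻ {a} {b} pa pb = subst (_≤ᶻ a *ᶻ b) (ℤP.*-zeroʳ a) (ℤP.*-monoˡ-≤-nonNeg a {{ℤ.nonNegative pa}} pb)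

*-cancel-posᶻ : ∀ {d x} → + 0 <ᶻ d → + 0 <ᶻ d *ᶻ x → + 0 <ᶻ x
*-cancel-posᶻ {d} {x} pd p = ℤP.*-cancelˡ-<-nonNeg d {{ℤ.nonNegative (ℤP.<⇒≤ pd)}} (subst (_<ᶻ d *ᶻ x) (sym (ℤP.*-zeroʳ d)) p)

*-cancel-nonNegᶻ : ∀ {d x} → + 0 <ᶻ d → + 0 ≤ᶻ d *ᶻ x → + 0 ≤ᶻ x
*-cancel-nonNegᶻ {d} {x} pd p = ℤP.*-cancelˡ-≤-pos (+ 0) x d {{ℤ.positive pd}} (subst (_≤ᶻ d *ᶻ x) (sym (ℤP.*-zeroʳ d)) p)

*≡0⇒≡0ᶻ : ∀ {d x} → + 0 <ᶻ d → d *ᶻ x ≡ + 0 → x ≡ + 0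
*≡0⇒≡0ᶻ {d} pd e with ℤP.i*j≡0⇒i≡0∨j≡0 d e
... | inj₁ d≡0 = ⊥-elim (ℤP.<-irrefl (sym d≡0) pd)
... | inj₂ x≡0 = x≡0

i<j⇒0<j-i : ∀ {i j} → i <ᶻ j → + 0 <ᶻ j -ᶻ i
i<j⇒0<j-i {i} {j} lt = subst (_<ᶻ j -ᶻ i) (ℤP.+-inverseʳ i) (ℤP.+-monoˡ-< (-ᶻ i) lt)

i*i-nonNeg : ∀ i → + 0 ≤ᶻ i *ᶻ i
i*i-nonNeg (+ n) = *-nonNegᶻ {+ n} {+ n} (ℤ.+≤+ ℕ.z≤n) (ℤ.+≤+ ℕ.z≤n)
i*i-nonNeg -[1+ n ] = ℤ.+≤+ ℕ.z≤n

i*i-pos : ∀ i → i ≢ + 0 → + 0 <ᶻ i *ᶻ i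
i*i-pos (+ zero) ne = ⊥-elim (ne refl)
i*i-pos (+ suc n) _ = ℤ.+<+ (ℕ.s≤s ℕ.z≤n)
i*i-pos -[1+ n ] _ = ℤ.+<+ (ℕ.s≤s ℕ.z≤n)

_⊖_ : Lattice → Lattice → Lattice
(x₁ , x₂) ⊖ (y₁ , y₂) = (x₁ -ᶻ y₁ , x₂ -ᶻ y₂)

_⊞_ : Lattice → Lattice → Lattice
(x₁ , x₂) ⊞ (y₁ , y₂) = (x₁ +ᶻ y₁ , x₂ +ᶻ y₂)

scale : ℕ → Lattice → Lattice
scale g (q₁ , q₂) = (q₁ *ᶻ + g , q₂ *ᶻ + g)

scale-1 : ∀ q → scale 1 q ≡ q
scale-1 (q₁ , q₂) = cong₂ _,_ (ℤP.*-identityʳ q₁) (ℤP.*-identityʳ q₂)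

⊖-⊞ : ∀ p x → x ≡ p ⊞ (x ⊖ p)
⊖-⊞ (p₁ , p₂) (x₁ , x₂) = cong₂ _,_ (shift p₁ x₁) (shift p₂ x₂)
  where
  shift : ∀ p x → x ≡ p +ᶻ (x -ᶻ p)
  shift = ZR.solve 2 (λ p x → x := p :+ (x :- p)) refl
    where open ZR

⊖≡0⇒≡ : ∀ x p → x ⊖ p ≡ (+ 0 , + 0) → x ≡ p
⊖≡0⇒≡ (x₁ , x₂) (p₁ , p₂) e = cong₂ _,_ (ℤP.i-j≡0⇒i≡j x₁ p₁ (cong proj₁ e)) (ℤP.i-j≡0⇒i≡j x₂ p₂ (cong proj₂ e))

⊖-self : ∀ a → a ⊖ a ≡ (+ 0 , + 0)
⊖-self (a₁ , a₂) = cong₂ _,_ (ℤP.+-inverseʳ a₁) (ℤP.+-inverseʳ a₂)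

squared-norm-pos : ∀ (a b : Lattice) → b ≢ a →
  + 0 <ᶻ (proj₁ b -ᶻ proj₁ a) *ᶻ (proj₁ b -ᶻ proj₁ a) +ᶻ (proj₂ b -ᶻ proj₂ a) *ᶻ (proj₂ b -ᶻ proj₂ a)
squared-norm-pos (a₁ , a₂) (b₁ , b₂) b≢a with (b₁ -ᶻ a₁) ℤP.≟ + 0 | (b₂ -ᶻ a₂) ℤP.≟ + 0
... | no d₁≢0 | _ = ℤP.+-mono-<-≤ (i*i-pos (b₁ -ᶻ a₁) d₁≢0) (i*i-nonNeg (b₂ -ᶻ a₂))
... | yes _ | no d₂≢0 = ℤP.+-mono-≤-< (i*i-nonNeg (b₁ -ᶻ a₁)) (i*i-pos (b₂ -ᶻ a₂) d₂≢0)
... | yes d₁≡0 | yes d₂≡0 = ⊥-elim (b≢a (⊖≡0⇒≡ (b₁ , b₂) (a₁ , a₂) (cong₂ _,_ d₁≡0 d₂≡0)))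

sumℚ-cong : ∀ {k} {f g : Fin k → ℚ} → (∀ i → f i ≡ g i) → sumℚ f ≡ sumℚ g
sumℚ-cong {zero} e = refl
sumℚ-cong {suc k} e = cong₂ _+_ (e zero) (sumℚ-cong (λ i → e (suc i)))

sumℚ-0 : ∀ k → sumℚ {k} (const 0ℚ) ≡ 0ℚ
sumℚ-0 zero = refl
sumℚ-0 (suc k) = trans (ℚP.+-identityˡ _) (sumℚ-0 k)

sumℚ-+ : ∀ {k} (f g : Fin k → ℚ) → sumℚ (λ i → f i + g i) ≡ sumℚ f + sumℚ g
sumℚ-+ {zero} f g = refl
sumℚ-+ {suc k} f g = trans (cong (λ t → (f zero + g zero) + t) (sumℚ-+ (λ i → f (suc i)) (λ i → g (suc i))))
  (QR.solve 4 (λ a b c d → (a :+ b) :+ (c :+ d) := (a :+ c) :+ (b :+ d)) refl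
    (f zero) (g zero) (sumℚ (λ i → f (suc i))) (sumℚ (λ i → g (suc i))))
  where open QR

sumℚ-*ˡ : ∀ {k} (c : ℚ) (f : Fin k → ℚ) → sumℚ (λ i → c * f i) ≡ c * sumℚ f
sumℚ-*ˡ {zero} c f = sym (ℚP.*-zeroʳ c)
sumℚ-*ˡ {suc k} c f =
  trans (cong (λ t → c * f zero + t) (sumℚ-*ˡ c (λ i → f (suc i)))) (sym (ℚP.*-distribˡ-+ c (f zero) _))

sumℚ-nonNeg : ∀ {k} (f : Fin k → ℚ) → (∀ i → 0ℚ ≤ f i) → 0ℚ ≤ sumℚ f
sumℚ-nonNeg {zero} f p = ℚP.≤-refl
sumℚ-nonNeg {suc k} f p = ℚP.+-mono-≤ (p zero) (sumℚ-nonNeg (λ i → f (suc i)) (λ i → p (suc i)))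

sumℚ-nonNeg-≡0 : ∀ {k} (f : Fin k → ℚ) → (∀ i → 0ℚ ≤ f i) → sumℚ f ≡ 0ℚ → ∀ i → f i ≡ 0ℚ
sumℚ-nonNeg-≡0 {suc k} f p e zero = +-nonNeg-≡0ˡ (p zero) (sumℚ-nonNeg _ (λ i → p (suc i))) e
sumℚ-nonNeg-≡0 {suc k} f p e (suc i) =
  sumℚ-nonNeg-≡0 (λ i → f (suc i)) (λ i → p (suc i)) (+-nonNeg-≡0ʳ (p zero) (sumℚ-nonNeg _ (λ i → p (suc i))) e) i

erase : ∀ {k} → Fin k → (Fin k → ℚ) → Fin k → ℚ
erase j f = updateAt f j (const 0ℚ)

erase-≡0 : ∀ {k} (j : Fin k) (f : Fin k → ℚ) i → (i ≢ j → f i ≡ 0ℚ) → erase j f i ≡ 0ℚ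
erase-≡0 j f i h with i ≟ᶠ j
... | yes refl = updateAt-updates j f
... | no i≢j = trans (updateAt-minimal i j f i≢j) (h i≢j)

erase-nonNeg : ∀ {k} (j : Fin k) (f : Fin k → ℚ) → (∀ i → 0ℚ ≤ f i) → ∀ i → 0ℚ ≤ erase j f i
erase-nonNeg j f nn i with i ≟ᶠ j
... | yes refl = ℚP.≤-reflexive (sym (updateAt-updates j f))
... | no i≢j = ℚP.≤-trans (nn i) (ℚP.≤-reflexive (sym (updateAt-minimal i j f i≢j)))

erase-* : ∀ {k} (j : Fin k) (f a : Fin k → ℚ) i → erase j (λ i → f i * a i) i ≡ erase j f i * a i
erase-* j f a i with i ≟ᶠ j
... | yes refl = trans (updateAt-updates j _) (sym (trans (cong (_* a j) (updateAt-updates j f)) (ℚP.*-zeroˡ (a j))))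
... | no i≢j = trans (updateAt-minimal i j _ i≢j) (cong (_* a i) (sym (updateAt-minimal i j f i≢j)))

sumℚ-extract : ∀ {k} (f : Fin k → ℚ) j → sumℚ f ≡ f j + sumℚ (erase j f)
sumℚ-extract f zero = cong (λ t → f zero + t) (sym (ℚP.+-identityˡ _))
sumℚ-extract f (suc j) = trans (cong (λ t → f zero + t) (sumℚ-extract (λ i → f (suc i)) j))
  (QR.solve 3 (λ a b c → a :+ (b :+ c) := b :+ (a :+ c)) refl (f zero) (f (suc j)) _)
  where open QR

sumℚ-single : ∀ {k} (f : Fin k → ℚ) j → (∀ i → i ≢ j → f i ≡ 0ℚ) → sumℚ f ≡ f j
sumℚ-single {k} f j z = begin
  sumℚ f                  ≡⟨ sumℚ-extract f j ⟩
  f j + sumℚ (erase j f)  ≡⟨ cong (λ t → f j + t) (trans (sumℚ-cong (λ i → erase-≡0 j f i (z i))) (sumℚ-0 k)) ⟩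
  f j + 0ℚ                ≡⟨ ℚP.+-identityʳ (f j) ⟩
  f j                     ∎
  where open ≡-Reasoning

sumℚ-pair : ∀ {k} (f : Fin k → ℚ) j j′ → j′ ≢ j → (∀ i → i ≢ j → i ≢ j′ → f i ≡ 0ℚ) → sumℚ f ≡ f j + f j′
sumℚ-pair f j j′ j′≢j z = trans (sumℚ-extract f j)
  (cong (λ t → f j + t) (trans (sumℚ-single (erase j f) j′ z′) (updateAt-minimal j′ j f j′≢j)))
  where
  z′ : ∀ i → i ≢ j′ → erase j f i ≡ 0ℚ
  z′ i i≢j′ = erase-≡0 j f i (λ i≢j → z i i≢j i≢j′)

sumPt-components : ∀ {k} (f : Fin k → Pt) → sumPt f ≡ (sumℚ (λ i → proj₁ (f i)) , sumℚ (λ i → proj₂ (f i)))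
sumPt-components {zero} f = refl
sumPt-components {suc k} f rewrite sumPt-components (λ i → f (suc i)) = refl

module _ {k} (λs : Fin k → ℚ) (p : Fin k → Pt) where
  sumPt-extract : ∀ j → sumPt (λ i → λs i · p i) ≡ (λs j · p j) ⊕ sumPt (λ i → erase j λs i · p i)
  sumPt-extract j = trans (sumPt-components _) (trans (cong₂ _,_ (extract proj₁) (extract proj₂))
    (cong ((λs j · p j) ⊕_) (sym (sumPt-components (λ i → erase j λs i · p i)))))
    where
    extract : (pr : Pt → ℚ) → sumℚ (λ i → λs i * pr (p i)) ≡ λs j * pr (p j) + sumℚ (λ i → erase j λs i * pr (p i))
    extract pr = trans (sumℚ-extract _ j) (cong (λ t → λs j * pr (p j) + t) (sumℚ-cong (erase-* j λs (λ i → pr (p i)))))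

  sumPt-single : ∀ j → (∀ i → i ≢ j → λs i ≡ 0ℚ) → sumPt (λ i → λs i · p i) ≡ λs j · p j
  sumPt-single j z = trans (sumPt-components _) (cong₂ _,_ (single proj₁) (single proj₂))
    where
    single : (pr : Pt → ℚ) → sumℚ (λ i → λs i * pr (p i)) ≡ λs j * pr (p j)
    single pr = sumℚ-single _ j (λ i i≢j → trans (cong (_* pr (p i)) (z i i≢j)) (ℚP.*-zeroˡ (pr (p i))))

  sumPt-pair : ∀ j j′ → j′ ≢ j → (∀ i → i ≢ j → i ≢ j′ → λs i ≡ 0ℚ) →
    sumPt (λ i → λs i · p i) ≡ (λs j · p j) ⊕ (λs j′ · p j′)
  sumPt-pair j j′ j′≢j z = trans (sumPt-components _) (cong₂ _,_ (pair proj₁) (pair proj₂))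
    where
    pair : (pr : Pt → ℚ) → sumℚ (λ i → λs i * pr (p i)) ≡ λs j * pr (p j) + λs j′ * pr (p j′)
    pair pr = sumℚ-pair _ j j′ j′≢j (λ i n n′ → trans (cong (_* pr (p i)) (z i n n′)) (ℚP.*-zeroˡ (pr (p i))))

-- Conic combinations and vertices

recip : (r : ℚ) → 0ℚ < r → ℚ
recip r pr = (ℚ.1/ r) {{ℚ.>-nonZero pr}}

recip-inverseˡ : ∀ r (pr : 0ℚ < r) → recip r pr * r ≡ 1ℚ
recip-inverseˡ r pr = ℚP.*-inverseˡ r {{ℚ.>-nonZero pr}}

recip-pos : ∀ r (pr : 0ℚ < r) → 0ℚ < recip r pr
recip-pos r pr = ℚP.positive⁻¹ (recip r pr) {{ℚP.1/pos⇒pos r {{ℚ.positive pr}}}}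

*-recip-cancel : ∀ r (pr : 0ℚ < r) a → r * (recip r pr * a) ≡ a
*-recip-cancel r pr a = begin
  r * (recip r pr * a)  ≡⟨ ℚP.*-assoc r (recip r pr) a ⟨
  (r * recip r pr) * a  ≡⟨ cong (_* a) (trans (ℚP.*-comm r (recip r pr)) (recip-inverseˡ r pr)) ⟩
  1ℚ * a                ≡⟨ ℚP.*-identityˡ a ⟩
  a                     ∎
  where open ≡-Reasoning

recip-*-cancel : ∀ r (pr : 0ℚ < r) a → recip r pr * (r * a) ≡ a
recip-*-cancel r pr a =
  trans (sym (ℚP.*-assoc (recip r pr) r a)) (trans (cong (_* a) (recip-inverseˡ r pr)) (ℚP.*-identityˡ a))

·-identityˡ : ∀ (x : Pt) → 1ℚ · x ≡ x
·-identityˡ (a , b) = cong₂ _,_ (ℚP.*-identityˡ a) (ℚP.*-identityˡ b)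

⊕-identityʳ : ∀ (x : Pt) → x ⊕ origin ≡ x
⊕-identityʳ (a , b) = cong₂ _,_ (ℚP.+-identityʳ a) (ℚP.+-identityʳ b)

-- x lies in the dilate s·P, witnessed by generator weights of total mass s; x ∈conv P is Conic P 1ℚ x.
Conic : LatticePolytope → ℚ → Pt → Set
Conic (k , v) s x =
  Σ (Fin k → ℚ) λ λs → ((i : Fin k) → 0ℚ ≤ λs i) × (sumℚ λs ≡ s) × (sumPt (λ i → λs i · embed (v i)) ≡ x)

conic-⊕ : ∀ {P s t x y} → Conic P s x → Conic P t y → Conic P (s + t) (x ⊕ y)
conic-⊕ {k , v} (λx , px , sx , ex) (λy , py , sy , ey) =
  (λ i → λx i + λy i) , (λ i → ℚP.+-mono-≤ (px i) (py i)) , trans (sumℚ-+ λx λy) (cong₂ _+_ sx sy) ,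
  trans (sumPt-components _) (trans (cong₂ _,_ (distrib proj₁) (distrib proj₂))
    (cong₂ _⊕_ (trans (sym (sumPt-components _)) ex) (trans (sym (sumPt-components _)) ey)))
  where
  distrib : (pr : Pt → ℚ) → sumℚ (λ i → (λx i + λy i) * pr (embed (v i))) ≡
                            sumℚ (λ i → λx i * pr (embed (v i))) + sumℚ (λ i → λy i * pr (embed (v i)))
  distrib pr = trans (sumℚ-cong (λ i → ℚP.*-distribʳ-+ (pr (embed (v i))) (λx i) (λy i)))
    (sumℚ-+ (λ i → λx i * pr (embed (v i))) (λ i → λy i * pr (embed (v i))))

conic-· : ∀ {P s x} c → 0ℚ ≤ c → Conic P s x → Conic P (c * s) (c · x)
conic-· {k , v} c pc (λx , px , sx , ex) =
  (λ i → c * λx i) , (λ i → *-nonNeg pc (px i)) , trans (sumℚ-*ˡ c λx) (cong (c *_) sx) ,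
  trans (sumPt-components _) (trans (cong₂ _,_ (assoc proj₁) (assoc proj₂)) (cong (c ·_) (trans (sym (sumPt-components _)) ex)))
  where
  assoc : (pr : Pt → ℚ) → sumℚ (λ i → (c * λx i) * pr (embed (v i))) ≡ c * sumℚ (λ i → λx i * pr (embed (v i)))
  assoc pr = trans (sumℚ-cong (λ i → ℚP.*-assoc c (λx i) (pr (embed (v i))))) (sumℚ-*ˡ c (λ i → λx i * pr (embed (v i))))

conic-origin : ∀ {P} → Conic P 0ℚ origin
conic-origin {k , v} = const 0ℚ , (λ _ → ℚP.≤-refl) , sumℚ-0 k ,
  trans (sumPt-components _) (cong₂ _,_ (vanish proj₁) (vanish proj₂))
  where
  vanish : (pr : Pt → ℚ) → sumℚ (λ i → 0ℚ * pr (embed (v i))) ≡ 0ℚ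
  vanish pr = trans (sumℚ-cong (λ i → ℚP.*-zeroˡ (pr (embed (v i))))) (sumℚ-0 k)

conic-generator : ∀ {k v} (j : Fin k) → embed (v j) ∈conv (k , v)
conic-generator {k} {v} j = δ , δ-nonNeg , trans (sumℚ-single δ j δ-off) δ-on ,
  trans (sumPt-single δ (λ i → embed (v i)) j δ-off) (trans (cong (_· embed (v j)) δ-on) (·-identityˡ (embed (v j))))
  where
  δ : Fin k → ℚ
  δ = updateAt (const 0ℚ) j (const 1ℚ)
  δ-on : δ j ≡ 1ℚ
  δ-on = updateAt-updates j (const 0ℚ)
  δ-off : ∀ i → i ≢ j → δ i ≡ 0ℚ
  δ-off i i≢j = updateAt-minimal i j (const 0ℚ) i≢j
  δ-nonNeg : ∀ i → 0ℚ ≤ δ i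
  δ-nonNeg i with i ≟ᶠ j
  ... | yes refl = ℚP.≤-trans (ℚP.<⇒≤ (ℚP.positive⁻¹ 1ℚ)) (ℚP.≤-reflexive (sym δ-on))
  ... | no i≢j = ℚP.≤-reflexive (sym (δ-off i i≢j))

conic-sum : ∀ {P m} (μ : Fin m → ℚ) (g : Fin m → Pt) → (∀ j → 0ℚ ≤ μ j) → (∀ j → g j ∈conv P) →
  Conic P (sumℚ μ) (sumPt (λ j → μ j · g j))
conic-sum {P} {zero} μ g pμ pg = conic-origin {P}
conic-sum {P} {suc m} μ g pμ pg = conic-⊕ {P}
  (subst (λ s → Conic P s (μ zero · g zero)) (ℚP.*-identityʳ (μ zero)) (conic-· {P} (μ zero) (pμ zero) (pg zero)))
  (conic-sum {P} (λ j → μ (suc j)) (λ j → g (suc j)) (λ j → pμ (suc j)) (λ j → pg (suc j)))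

hull-⊆P : ∀ {P m} (u : Fin m → Lattice) → (∀ j → embed (u j) ∈conv P) → (m , u) ⊆P P
hull-⊆P {P} u u∈P x (μ , pμ , sμ , eμ) = subst₂ (Conic P) sμ eμ (conic-sum {P} μ (λ j → embed (u j)) pμ u∈P)

conic-normalise : ∀ {P r y} (pr : 0ℚ < r) → Conic P r y → (recip r pr · y) ∈conv P
conic-normalise {P} {r} {y} pr c =
  subst (λ s → Conic P s (recip r pr · y)) (recip-inverseˡ r pr) (conic-· {P} (recip r pr) (ℚP.<⇒≤ (recip-pos r pr)) c)

conic-nonNeg : ∀ {P s x} → Conic P s x → 0ℚ ≤ s
conic-nonNeg (λs , nn , refl , _) = sumℚ-nonNeg λs nn

conic-0 : ∀ {k v y} → Conic (k , v) 0ℚ y → y ≡ origin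
conic-0 {k} {v} (λs , nn , s0 , refl) = trans (sumPt-components _) (cong₂ _,_ (vanish proj₁) (vanish proj₂))
  where
  vanish : (pr : Pt → ℚ) → sumℚ (λ i → λs i * pr (embed (v i))) ≡ 0ℚ
  vanish pr = trans (sumℚ-cong (λ i → trans (cong (_* pr (embed (v i))) (sumℚ-nonNeg-≡0 λs nn s0 i)) (ℚP.*-zeroˡ (pr (embed (v i))))))
                    (sumℚ-0 k)

conic-split : ∀ {k v s x} (c : Conic (k , v) s x) (j : Fin k) →
  Σ Pt λ y → Conic (k , v) (s - proj₁ c j) y × x ≡ (proj₁ c j · embed (v j)) ⊕ y
conic-split {k} {v} (λs , nn , refl , refl) j =
  _ , (erase j λs , erase-nonNeg j λs nn , +≡⇒≡- (sym (sumℚ-extract λs j)) , refl) ,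
  sumPt-extract λs (λ i → embed (v i)) j

combination₃ : ∀ {P} {X Y Z y : Pt} {a b c : ℚ} → X ∈conv P → Y ∈conv P → Z ∈conv P →
  0ℚ ≤ a → 0ℚ ≤ b → 0ℚ ≤ c → (pD : 0ℚ < (a + b) + c) →
  ((a + b) + c) · y ≡ ((a · X) ⊕ (b · Y)) ⊕ (c · Z) → y ∈conv P
combination₃ {P} {y = y} {a} {b} {c} X∈ Y∈ Z∈ pa pb pc pD e =
  subst (_∈conv P) (cong₂ _,_ (recip-*-cancel D pD (proj₁ y)) (recip-*-cancel D pD (proj₂ y)))
    (conic-normalise {P} pD (subst₂ (Conic P) weights (sym e)
      (conic-⊕ {P} (conic-⊕ {P} (conic-· {P} a pa X∈) (conic-· {P} b pb Y∈)) (conic-· {P} c pc Z∈))))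
  where
  D = (a + b) + c
  weights : (a * 1ℚ + b * 1ℚ) + c * 1ℚ ≡ D
  weights = cong₂ _+_ (cong₂ _+_ (ℚP.*-identityʳ a) (ℚP.*-identityʳ b)) (ℚP.*-identityʳ c)

positive-weight : ∀ {k} (f : Fin k → ℚ) → (∀ i → 0ℚ ≤ f i) → sumℚ f ≡ 1ℚ → ∃ λ j → 0ℚ < f j
positive-weight {zero} f nn ()
positive-weight {suc k} f nn s with ℚP.<-cmp 0ℚ (f zero)
... | tri< lt _ _ = zero , lt
... | tri> _ _ gt = ⊥-elim (ℚP.<-irrefl refl (ℚP.<-≤-trans gt (nn zero)))
... | tri≈ _ eq _ with positive-weight (λ i → f (suc i)) (λ i → nn (suc i))
        (trans (sym (ℚP.+-identityˡ _)) (trans (cong (_+ sumℚ (λ i → f (suc i))) eq) s))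
...   | j , pj = suc j , pj

-- Split off a generator of positive weight λ: for λ < 1 the vertex is a proper combination of that
-- generator and the rest, so it equals the generator; for λ = 1 the rest is empty.
vertex⇒generator : ∀ {k v x} → IsVertex (k , v) x → ∃ λ j → embed (v j) ≡ x
vertex⇒generator {k} {v} {x} (x∈@(λs , nn , s1 , ex) , extreme) with positive-weight λs nn s1
... | j , pj with conic-split {k} {v} x∈ j
... | y , y∈ , x≡ with ℚP.<-cmp (λs j) 1ℚ
...   | tri< lt _ _ = j , extreme (embed (v j)) q (λs j) (conic-generator {k} {v} j) (conic-normalise {k , v} pr y∈) pj lt x≡′
  where
  pr = p<q⇒0<q-p lt
  q = recip (1ℚ - λs j) pr · y
  x≡′ : x ≡ (λs j · embed (v j)) ⊕ ((1ℚ - λs j) · q)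
  x≡′ = trans x≡ (cong ((λs j · embed (v j)) ⊕_)
          (sym (cong₂ _,_ (*-recip-cancel _ pr (proj₁ y)) (*-recip-cancel _ pr (proj₂ y)))))
...   | tri≈ _ e _ = j , sym (begin
  x                                    ≡⟨ x≡ ⟩
  (λs j · embed (v j)) ⊕ y             ≡⟨ cong₂ _⊕_ (trans (cong (_· embed (v j)) e) (·-identityˡ (embed (v j)))) (conic-0 {k} {v} y∈0) ⟩
  embed (v j) ⊕ origin                 ≡⟨ ⊕-identityʳ _ ⟩
  embed (v j)                          ∎)
  where
  open ≡-Reasoning
  y∈0 : Conic (k , v) 0ℚ y
  y∈0 = subst (λ s → Conic (k , v) s y) (trans (cong (λ t → 1ℚ - t) e) (ℚP.+-inverseʳ 1ℚ)) y∈
...   | tri> _ _ gt = ⊥-elim (ℚP.<-irrefl refl (ℚP.<-≤-trans gt (0≤q-p⇒p≤q (conic-nonNeg {k , v} y∈))))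

private
  triangle-weights : ∀ a b c iD iA w x y z → iD * ((a + b) + c) ≡ 1ℚ → iA * (a + c) ≡ 1ℚ →
    ((a + b) + c) * w ≡ (a * x + b * y) + c * z →
    w ≡ (b * iD) * y + (1ℚ - b * iD) * (iA * (a * x + c * z))
  triangle-weights a b c iD iA w x y z hD hA e = sym (begin
    (b * iD) * y + (1ℚ - b * iD) * (iA * (a * x + c * z))
      ≡⟨ cong (λ u → (b * iD) * y + (u - b * iD) * (iA * (a * x + c * z))) (sym hD) ⟩
    (b * iD) * y + (iD * ((a + b) + c) - b * iD) * (iA * (a * x + c * z))
      ≡⟨ QR.solve 8 (λ a b c iD iA x y z →
           (b :* iD) :* y :+ (iD :* ((a :+ b) :+ c) :- b :* iD) :* (iA :* (a :* x :+ c :* z))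
           := iD :* (b :* y) :+ iD :* ((iA :* (a :+ c)) :* (a :* x :+ c :* z))) refl a b c iD iA x y z ⟩
    iD * (b * y) + iD * ((iA * (a + c)) * (a * x + c * z))
      ≡⟨ cong (λ u → iD * (b * y) + iD * (u * (a * x + c * z))) hA ⟩
    iD * (b * y) + iD * (1ℚ * (a * x + c * z))
      ≡⟨ QR.solve 7 (λ a b c iD x y z →
           iD :* (b :* y) :+ iD :* (con 1ℚ :* (a :* x :+ c :* z)) := iD :* ((a :* x :+ b :* y) :+ c :* z))
           refl a b c iD x y z ⟩
    iD * ((a * x + b * y) + c * z)  ≡⟨ cong (iD *_) (sym e) ⟩
    iD * (((a + b) + c) * w)        ≡⟨ sym (ℚP.*-assoc iD _ w) ⟩
    (iD * ((a + b) + c)) * w        ≡⟨ cong (_* w) hD ⟩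
    1ℚ * w                          ≡⟨ ℚP.*-identityˡ w ⟩
    w                               ∎)
    where
    open ≡-Reasoning
    open QR using (_:+_; _:*_; _:-_; _:=_; con)

-- W = t Y + (1 - t) q with t = b / (a + b + c) and q = (a X + c Z) / (a + c).
vertex-combination : ∀ {P W X Y Z} (a b c : ℚ) → IsVertex P W → X ∈conv P → Y ∈conv P → Z ∈conv P →
  0ℚ ≤ a → 0ℚ < b → 0ℚ ≤ c → 0ℚ < a + c →
  ((a + b) + c) · W ≡ ((a · X) ⊕ (b · Y)) ⊕ (c · Z) → Y ≡ W
vertex-combination {P} {W} {X} {Y} {Z} a b c (_ , extreme) X∈ Y∈ Z∈ pa pb pc pac e =
  extreme Y q t Y∈ q∈ pt t<1 W≡
  where
  D = (a + b) + c
  pD : 0ℚ < D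
  pD = ℚP.+-mono-<-≤ (ℚP.+-mono-≤-< pa pb) pc
  iD = recip D pD
  iA = recip (a + c) pac
  t = b * iD
  pt : 0ℚ < t
  pt = *-pos pb (recip-pos D pD)
  t<1 : t < 1ℚ
  t<1 = 0<q-p⇒p<q (ℚP.<-≤-trans (*-pos pac (recip-pos D pD)) (ℚP.≤-reflexive 1-t))
    where
    1-t : (a + c) * iD ≡ 1ℚ - t
    1-t = trans (QR.solve 4 (λ a b c iD → (a :+ c) :* iD := iD :* ((a :+ b) :+ c) :- b :* iD) refl a b c iD)
                (cong (_- t) (recip-inverseˡ D pD))
      where open QR
  q = iA · ((a · X) ⊕ (c · Z))
  q∈ : q ∈conv P
  q∈ = conic-normalise {P} pac (subst (λ s → Conic P s ((a · X) ⊕ (c · Z)))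
         (cong₂ _+_ (ℚP.*-identityʳ a) (ℚP.*-identityʳ c)) (conic-⊕ {P} (conic-· {P} a pa X∈) (conic-· {P} c pc Z∈)))
  W≡ : W ≡ (t · Y) ⊕ ((1ℚ - t) · q)
  W≡ = cong₂ _,_
    (triangle-weights a b c iD iA (proj₁ W) (proj₁ X) (proj₁ Y) (proj₁ Z) (recip-inverseˡ D pD) (recip-inverseˡ _ pac) (cong proj₁ e))
    (triangle-weights a b c iD iA (proj₂ W) (proj₂ X) (proj₂ Y) (proj₂ Z) (recip-inverseˡ D pD) (recip-inverseˡ _ pac) (cong proj₂ e))

Affine : Set
Affine = ℚ × ℚ × ℚ

ev : Affine → Pt → ℚ
ev (c₀ , c₁ , c₂) x = c₀ + (c₁ * proj₁ x + c₂ * proj₂ x)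

_+ᵃ_ : Affine → Affine → Affine
(a₀ , a₁ , a₂) +ᵃ (b₀ , b₁ , b₂) = (a₀ + b₀ , a₁ + b₁ , a₂ + b₂)

ev-+ᵃ : ∀ φ ψ x → ev (φ +ᵃ ψ) x ≡ ev φ x + ev ψ x
ev-+ᵃ (a₀ , a₁ , a₂) (b₀ , b₁ , b₂) (x₁ , x₂) = QR.solve 8 (λ a₀ a₁ a₂ b₀ b₁ b₂ x₁ x₂ →
  (a₀ :+ b₀) :+ ((a₁ :+ b₁) :* x₁ :+ (a₂ :+ b₂) :* x₂) :=
  (a₀ :+ (a₁ :* x₁ :+ a₂ :* x₂)) :+ (b₀ :+ (b₁ :* x₁ :+ b₂ :* x₂))) refl a₀ a₁ a₂ b₀ b₁ b₂ x₁ x₂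
  where open QR

ev-combination : ∀ (φ : Affine) (t : ℚ) (p q : Pt) → ev φ ((t · p) ⊕ ((1ℚ - t) · q)) ≡ t * ev φ p + (1ℚ - t) * ev φ q
ev-combination (c₀ , c₁ , c₂) t (p₁ , p₂) (q₁ , q₂) = QR.solve 8 (λ c₀ c₁ c₂ t p₁ p₂ q₁ q₂ →
    c₀ :+ (c₁ :* (t :* p₁ :+ (con 1ℚ :- t) :* q₁) :+ c₂ :* (t :* p₂ :+ (con 1ℚ :- t) :* q₂))
    := t :* (c₀ :+ (c₁ :* p₁ :+ c₂ :* p₂)) :+ (con 1ℚ :- t) :* (c₀ :+ (c₁ :* q₁ :+ c₂ :* q₂)))
  refl c₀ c₁ c₂ t p₁ p₂ q₁ q₂
  where open QR

ev-conv : ∀ {k v x} (φ : Affine) (c : x ∈conv (k , v)) → ev φ x ≡ sumℚ (λ i → proj₁ c i * ev φ (embed (v i)))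
ev-conv {k} {v} φ@(c₀ , c₁ , c₂) (λs , _ , s1 , refl) = sym (begin
  sumℚ (λ i → λs i * ev φ (p i))
    ≡⟨ sumℚ-cong (λ i → expand (λs i) (p i)) ⟩
  sumℚ (λ i → c₀ * λs i + (c₁ * (λs i * proj₁ (p i)) + c₂ * (λs i * proj₂ (p i))))
    ≡⟨ sumℚ-+ (λ i → c₀ * λs i) (λ i → c₁ * (λs i * proj₁ (p i)) + c₂ * (λs i * proj₂ (p i))) ⟩
  sumℚ (λ i → c₀ * λs i) + sumℚ (λ i → c₁ * (λs i * proj₁ (p i)) + c₂ * (λs i * proj₂ (p i)))
    ≡⟨ cong₂ _+_ (sumℚ-*ˡ c₀ λs) (trans (sumℚ-+ (λ i → c₁ * (λs i * proj₁ (p i))) (λ i → c₂ * (λs i * proj₂ (p i))))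
                                      (cong₂ _+_ (sumℚ-*ˡ c₁ (λ i → λs i * proj₁ (p i))) (sumℚ-*ˡ c₂ (λ i → λs i * proj₂ (p i))))) ⟩
  c₀ * sumℚ λs + (c₁ * S₁ + c₂ * S₂)
    ≡⟨ cong (λ s → c₀ * s + (c₁ * S₁ + c₂ * S₂)) s1 ⟩
  c₀ * 1ℚ + (c₁ * S₁ + c₂ * S₂)
    ≡⟨ cong (_+ (c₁ * S₁ + c₂ * S₂)) (ℚP.*-identityʳ c₀) ⟩
  c₀ + (c₁ * S₁ + c₂ * S₂)
    ≡⟨ cong (ev φ) (sym (sumPt-components (λ i → λs i · p i))) ⟩
  ev φ (sumPt (λ i → λs i · p i)) ∎)
  where
  open ≡-Reasoning
  p : Fin k → Pt
  p i = embed (v i)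
  S₁ = sumℚ (λ i → λs i * proj₁ (p i))
  S₂ = sumℚ (λ i → λs i * proj₂ (p i))
  expand : ∀ l (x : Pt) → l * ev φ x ≡ c₀ * l + (c₁ * (l * proj₁ x) + c₂ * (l * proj₂ x))
  expand l (x₁ , x₂) = QR.solve 6 (λ c₀ c₁ c₂ l x₁ x₂ →
    l :* (c₀ :+ (c₁ :* x₁ :+ c₂ :* x₂)) := c₀ :* l :+ (c₁ :* (l :* x₁) :+ c₂ :* (l :* x₂))) refl c₀ c₁ c₂ l x₁ x₂
    where open QR

ev-nonNeg : ∀ {k v x} (φ : Affine) → (∀ i → 0ℚ ≤ ev φ (embed (v i))) → x ∈conv (k , v) → 0ℚ ≤ ev φ x
ev-nonNeg {k} {v} φ h c@(λs , nn , _) =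
  ℚP.≤-trans (sumℚ-nonNeg _ (λ i → *-nonNeg (nn i) (h i))) (ℚP.≤-reflexive (sym (ev-conv {k} {v} φ c)))

ev-zero⇒weight-zero : ∀ {k v x} (φ : Affine) → (∀ i → 0ℚ ≤ ev φ (embed (v i))) → (c : x ∈conv (k , v)) →
  ev φ x ≡ 0ℚ → ∀ i → 0ℚ < ev φ (embed (v i)) → proj₁ c i ≡ 0ℚ
ev-zero⇒weight-zero {k} {v} φ h c@(λs , nn , _) z i pi = *-pos-≡0ˡ (nn i) pi
  (sumℚ-nonNeg-≡0 (λ i → λs i * ev φ (embed (v i))) (λ i → *-nonNeg (nn i) (h i)) (trans (sym (ev-conv {k} {v} φ c)) z) i)

Exposes : ∀ {k} → (Fin k → Lattice) → Affine → Fin k → Set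
Exposes v φ j = (ev φ (embed (v j)) ≡ 0ℚ) × (∀ i → i ≢ j → 0ℚ < ev φ (embed (v i)))

exposes⇒nonNeg : ∀ {k v φ j} → Exposes {k} v φ j → ∀ i → 0ℚ ≤ ev φ (embed (v i))
exposes⇒nonNeg {j = j} (h0 , hp) i with i ≟ᶠ j
... | yes refl = ℚP.≤-reflexive (sym h0)
... | no i≢j = ℚP.<⇒≤ (hp i i≢j)

exposes⇒unique-zero : ∀ {k v x} {φ : Affine} {j : Fin k} → Exposes v φ j → x ∈conv (k , v) → ev φ x ≡ 0ℚ → x ≡ embed (v j)
exposes⇒unique-zero {k} {v} {x} {φ} {j} ex@(_ , hp) c@(λs , _ , s1 , refl) z = begin
  sumPt (λ i → λs i · embed (v i))  ≡⟨ sumPt-single λs (λ i → embed (v i)) j off ⟩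
  λs j · embed (v j)                ≡⟨ cong (_· embed (v j)) (trans (sym (sumℚ-single λs j off)) s1) ⟩
  1ℚ · embed (v j)                  ≡⟨ ·-identityˡ (embed (v j)) ⟩
  embed (v j)                       ∎
  where
  open ≡-Reasoning
  off : ∀ i → i ≢ j → λs i ≡ 0ℚ
  off i i≢j = ev-zero⇒weight-zero {k} {v} φ (exposes⇒nonNeg {k} {v} {φ} {j} ex) c z i (hp i i≢j)

exposes⇒vertex : ∀ {k v} {φ : Affine} {j : Fin k} → Exposes v φ j → IsVertex (k , v) (embed (v j))
exposes⇒vertex {k} {v} {φ} {j} ex@(h0 , _) = conic-generator {k} {v} j , extreme
  where
  nonNeg : ∀ {y} → y ∈conv (k , v) → 0ℚ ≤ ev φ y
  nonNeg = ev-nonNeg {k} {v} φ (exposes⇒nonNeg {k} {v} {φ} {j} ex)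
  extreme : (p q : Pt) (t : ℚ) → p ∈conv (k , v) → q ∈conv (k , v) → 0ℚ < t → t < 1ℚ →
            embed (v j) ≡ (t · p) ⊕ ((1ℚ - t) · q) → p ≡ embed (v j)
  extreme p q t p∈ q∈ pt t<1 e = exposes⇒unique-zero {k} {v} {p} {φ} {j} ex p∈ (*-pos-≡0ˡ (nonNeg p∈) pt (trans (ℚP.*-comm _ t) tφp≡0))
    where
    tφp≡0 : t * ev φ p ≡ 0ℚ
    tφp≡0 = +-nonNeg-≡0ˡ (*-nonNeg (ℚP.<⇒≤ pt) (nonNeg p∈)) (*-nonNeg (p≤q⇒0≤q-p (ℚP.<⇒≤ t<1)) (nonNeg q∈))
              (trans (sym (ev-combination φ t p q)) (trans (cong (ev φ) (sym e)) h0))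

-- Orientation determinants

det : Lattice → Lattice → Lattice → ℤ
det (a₁ , a₂) (b₁ , b₂) (c₁ , c₂) = (b₁ -ᶻ a₁) *ᶻ (c₂ -ᶻ a₂) -ᶻ (b₂ -ᶻ a₂) *ᶻ (c₁ -ᶻ a₁)

detℚ : Pt → Pt → Pt → ℚ
detℚ (a₁ , a₂) (b₁ , b₂) (c₁ , c₂) = (b₁ - a₁) * (c₂ - a₂) - (b₂ - a₂) * (c₁ - a₁)

private
  detᶻᴾ : ∀ {n} (u₁ u₂ v₁ v₂ w₁ w₂ : ZR.Polynomial n) → ZR.Polynomial n
  detᶻᴾ u₁ u₂ v₁ v₂ w₁ w₂ = (v₁ :- u₁) :* (w₂ :- u₂) :- (v₂ :- u₂) :* (w₁ :- u₁)
    where open ZR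

  detℚᴾ : ∀ {n} (u₁ u₂ v₁ v₂ w₁ w₂ : QR.Polynomial n) → QR.Polynomial n
  detℚᴾ u₁ u₂ v₁ v₂ w₁ w₂ = (v₁ :- u₁) :* (w₂ :- u₂) :- (v₂ :- u₂) :* (w₁ :- u₁)
    where open QR

det-cyclic : ∀ a b c → det a b c ≡ det b c a
det-cyclic (a₁ , a₂) (b₁ , b₂) (c₁ , c₂) =
  solve 6 (λ a₁ a₂ b₁ b₂ c₁ c₂ → detᶻᴾ a₁ a₂ b₁ b₂ c₁ c₂ := detᶻᴾ b₁ b₂ c₁ c₂ a₁ a₂)
    refl a₁ a₂ b₁ b₂ c₁ c₂
  where open ZR

det-aab : ∀ a c → det a a c ≡ + 0
det-aab (a₁ , a₂) (c₁ , c₂) = solve 4 (λ a₁ a₂ c₁ c₂ → detᶻᴾ a₁ a₂ a₁ a₂ c₁ c₂ := con (+ 0)) refl a₁ a₂ c₁ c₂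
  where open ZR

det-abb : ∀ a b → det a b b ≡ + 0
det-abb a b = trans (det-cyclic a b b) (det-aab b a)

det-aba : ∀ a b → det a b a ≡ + 0
det-aba a b = trans (det-cyclic a b a) (det-abb b a)

det-swap₂₃ : ∀ p x y → det p y x ≡ -ᶻ det p x y
det-swap₂₃ (p₁ , p₂) (x₁ , x₂) (y₁ , y₂) =
  solve 6 (λ p₁ p₂ x₁ x₂ y₁ y₂ → detᶻᴾ p₁ p₂ y₁ y₂ x₁ x₂ := :- detᶻᴾ p₁ p₂ x₁ x₂ y₁ y₂)
    refl p₁ p₂ x₁ x₂ y₁ y₂
  where open ZR

det-swap₁₂ : ∀ a b c → det b a c ≡ -ᶻ det a b c
det-swap₁₂ a b c = trans (det-cyclic b a c) (det-swap₂₃ a b c)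

-- X ↦ det X P Q is affine, and (det X B C , det A X C , det A B X) / det A B C are the barycentric
-- coordinates of X in the triangle ABC.
det-barycentric : ∀ (A B C X P Q : Lattice) →
  det A B C *ᶻ det X P Q ≡ (det X B C *ᶻ det A P Q +ᶻ det A X C *ᶻ det B P Q) +ᶻ det A B X *ᶻ det C P Q
det-barycentric (a₁ , a₂) (b₁ , b₂) (c₁ , c₂) (x₁ , x₂) (p₁ , p₂) (q₁ , q₂) =
  solve 12 (λ a₁ a₂ b₁ b₂ c₁ c₂ x₁ x₂ p₁ p₂ q₁ q₂ →
    detᶻᴾ a₁ a₂ b₁ b₂ c₁ c₂ :* detᶻᴾ x₁ x₂ p₁ p₂ q₁ q₂ :=
    (detᶻᴾ x₁ x₂ b₁ b₂ c₁ c₂ :* detᶻᴾ a₁ a₂ p₁ p₂ q₁ q₂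
      :+ detᶻᴾ a₁ a₂ x₁ x₂ c₁ c₂ :* detᶻᴾ b₁ b₂ p₁ p₂ q₁ q₂)
      :+ detᶻᴾ a₁ a₂ b₁ b₂ x₁ x₂ :* detᶻᴾ c₁ c₂ p₁ p₂ q₁ q₂)
    refl a₁ a₂ b₁ b₂ c₁ c₂ x₁ x₂ p₁ p₂ q₁ q₂
  where open ZR

barycentric-coordinates : ∀ (A B C X : Lattice) (pr : Lattice → ℤ) → pr ≡ proj₁ ⊎ pr ≡ proj₂ →
  ((det X B C +ᶻ det A X C) +ᶻ det A B X) *ᶻ pr X ≡ (det X B C *ᶻ pr A +ᶻ det A X C *ᶻ pr B) +ᶻ det A B X *ᶻ pr C
barycentric-coordinates (a₁ , a₂) (b₁ , b₂) (c₁ , c₂) (x₁ , x₂) pr (inj₁ refl) =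
  solve 8 (λ a₁ a₂ b₁ b₂ c₁ c₂ x₁ x₂ →
    ((detᶻᴾ x₁ x₂ b₁ b₂ c₁ c₂ :+ detᶻᴾ a₁ a₂ x₁ x₂ c₁ c₂) :+ detᶻᴾ a₁ a₂ b₁ b₂ x₁ x₂) :* x₁ :=
    (detᶻᴾ x₁ x₂ b₁ b₂ c₁ c₂ :* a₁ :+ detᶻᴾ a₁ a₂ x₁ x₂ c₁ c₂ :* b₁) :+ detᶻᴾ a₁ a₂ b₁ b₂ x₁ x₂ :* c₁)
    refl a₁ a₂ b₁ b₂ c₁ c₂ x₁ x₂
  where open ZR
barycentric-coordinates (a₁ , a₂) (b₁ , b₂) (c₁ , c₂) (x₁ , x₂) pr (inj₂ refl) =
  solve 8 (λ a₁ a₂ b₁ b₂ c₁ c₂ x₁ x₂ →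
    ((detᶻᴾ x₁ x₂ b₁ b₂ c₁ c₂ :+ detᶻᴾ a₁ a₂ x₁ x₂ c₁ c₂) :+ detᶻᴾ a₁ a₂ b₁ b₂ x₁ x₂) :* x₂ :=
    (detᶻᴾ x₁ x₂ b₁ b₂ c₁ c₂ :* a₂ :+ detᶻᴾ a₁ a₂ x₁ x₂ c₁ c₂ :* b₂) :+ detᶻᴾ a₁ a₂ b₁ b₂ x₁ x₂ :* c₂)
    refl a₁ a₂ b₁ b₂ c₁ c₂ x₁ x₂
  where open ZR

ι-det : ∀ a b c → ι (det a b c) ≡ detℚ (embed a) (embed b) (embed c)
ι-det (a₁ , a₂) (b₁ , b₂) (c₁ , c₂) =
  trans (ι-homo-sub ((b₁ -ᶻ a₁) *ᶻ (c₂ -ᶻ a₂)) ((b₂ -ᶻ a₂) *ᶻ (c₁ -ᶻ a₁)))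
    (cong₂ _-_ (trans (ι-homo-* (b₁ -ᶻ a₁) (c₂ -ᶻ a₂)) (cong₂ _*_ (ι-homo-sub b₁ a₁) (ι-homo-sub c₂ a₂)))
               (trans (ι-homo-* (b₂ -ᶻ a₂) (c₁ -ᶻ a₁)) (cong₂ _*_ (ι-homo-sub b₂ a₂) (ι-homo-sub c₁ a₁))))

ι-combination : ∀ (A B C X : Lattice) (α β γ : ℤ) →
  ((α +ᶻ β) +ᶻ γ) *ᶻ proj₁ X ≡ (α *ᶻ proj₁ A +ᶻ β *ᶻ proj₁ B) +ᶻ γ *ᶻ proj₁ C →
  ((α +ᶻ β) +ᶻ γ) *ᶻ proj₂ X ≡ (α *ᶻ proj₂ A +ᶻ β *ᶻ proj₂ B) +ᶻ γ *ᶻ proj₂ C →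
  ((ι α + ι β) + ι γ) · embed X ≡ ((ι α · embed A) ⊕ (ι β · embed B)) ⊕ (ι γ · embed C)
ι-combination A B C X α β γ e₁ e₂ = cong₂ _,_ (lift proj₁ e₁) (lift proj₂ e₂)
  where
  open ≡-Reasoning
  lift : (pr : Lattice → ℤ) → ((α +ᶻ β) +ᶻ γ) *ᶻ pr X ≡ (α *ᶻ pr A +ᶻ β *ᶻ pr B) +ᶻ γ *ᶻ pr C →
         ((ι α + ι β) + ι γ) * ι (pr X) ≡ (ι α * ι (pr A) + ι β * ι (pr B)) + ι γ * ι (pr C)
  lift pr e = begin
    ((ι α + ι β) + ι γ) * ι (pr X)
      ≡⟨ cong (_* ι (pr X)) (trans (ι-homo-+ (α +ᶻ β) γ) (cong (_+ ι γ) (ι-homo-+ α β))) ⟨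
    ι ((α +ᶻ β) +ᶻ γ) * ι (pr X)                ≡⟨ ι-homo-* ((α +ᶻ β) +ᶻ γ) (pr X) ⟨
    ι (((α +ᶻ β) +ᶻ γ) *ᶻ pr X)                 ≡⟨ cong ι e ⟩
    ι ((α *ᶻ pr A +ᶻ β *ᶻ pr B) +ᶻ γ *ᶻ pr C)
      ≡⟨ trans (ι-homo-+ (α *ᶻ pr A +ᶻ β *ᶻ pr B) (γ *ᶻ pr C))
           (cong₂ _+_ (trans (ι-homo-+ (α *ᶻ pr A) (β *ᶻ pr B)) (cong₂ _+_ (ι-homo-* α (pr A)) (ι-homo-* β (pr B))))
                      (ι-homo-* γ (pr C))) ⟩
    (ι α * ι (pr A) + ι β * ι (pr B)) + ι γ * ι (pr C) ∎

ι-combination₂ : ∀ (A B X : Lattice) (α β : ℤ) →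
  (α +ᶻ β) *ᶻ proj₁ X ≡ α *ᶻ proj₁ A +ᶻ β *ᶻ proj₁ B → (α +ᶻ β) *ᶻ proj₂ X ≡ α *ᶻ proj₂ A +ᶻ β *ᶻ proj₂ B →
  ((ι α + ι β) + 0ℚ) · embed X ≡ ((ι α · embed A) ⊕ (ι β · embed B)) ⊕ (0ℚ · embed A)
ι-combination₂ A B X α β e₁ e₂ = ι-combination A B A X α β (+ 0) (pad proj₁ e₁) (pad proj₂ e₂)
  where
  pad : (pr : Lattice → ℤ) → (α +ᶻ β) *ᶻ pr X ≡ α *ᶻ pr A +ᶻ β *ᶻ pr B →
        ((α +ᶻ β) +ᶻ + 0) *ᶻ pr X ≡ (α *ᶻ pr A +ᶻ β *ᶻ pr B) +ᶻ + 0 *ᶻ pr A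
  pad pr e = trans (cong (_*ᶻ pr X) (ℤP.+-identityʳ (α +ᶻ β))) (trans e (sym (ℤP.+-identityʳ (α *ᶻ pr A +ᶻ β *ᶻ pr B))))

ι-barycentric : ∀ (A B C X : Lattice) →
  let α = det X B C ; β = det A X C ; γ = det A B X in
  ((ι α + ι β) + ι γ) · embed X ≡ ((ι α · embed A) ⊕ (ι β · embed B)) ⊕ (ι γ · embed C)
ι-barycentric A B C X = ι-combination A B C X (det X B C) (det A X C) (det A B X)
  (barycentric-coordinates A B C X proj₁ (inj₁ refl)) (barycentric-coordinates A B C X proj₂ (inj₂ refl))

-- The hypotheses are the barycentric weights of X; the positive one keeps their sum det A B C positive.
triangle-⊆ : ∀ {P} (A B C X : Lattice) → embed A ∈conv P → embed B ∈conv P → embed C ∈conv P →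
  + 0 ≤ᶻ det X B C → + 0 <ᶻ det A X C → + 0 ≤ᶻ det A B X → embed X ∈conv P
triangle-⊆ {P} A B C X A∈ B∈ C∈ α≥0 β>0 γ≥0 =
  combination₃ {P} A∈ B∈ C∈ (ι-mono-≤ α≥0) (ι-mono-≤ (ℤP.<⇒≤ β>0)) (ι-mono-≤ γ≥0)
    (ℚP.+-mono-<-≤ (ℚP.+-mono-≤-< (ι-mono-≤ α≥0) (ι-mono-< β>0)) (ι-mono-≤ γ≥0)) (ι-barycentric A B C X)

segment-point∈ : ∀ {P} (A B X : Lattice) (α β : ℤ) → embed A ∈conv P → embed B ∈conv P → + 0 ≤ᶻ α → + 0 <ᶻ β →
  (α +ᶻ β) *ᶻ proj₁ X ≡ α *ᶻ proj₁ A +ᶻ β *ᶻ proj₁ B → (α +ᶻ β) *ᶻ proj₂ X ≡ α *ᶻ proj₂ A +ᶻ β *ᶻ proj₂ B →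
  embed X ∈conv P
segment-point∈ {P} A B X α β A∈ B∈ α≥0 β>0 e₁ e₂ =
  combination₃ {P} A∈ B∈ A∈ (ι-mono-≤ α≥0) (ι-mono-≤ (ℤP.<⇒≤ β>0)) ℚP.≤-refl
    (subst (0ℚ <_) (sym (ℚP.+-identityʳ (ι α + ι β))) (ℚP.+-mono-≤-< (ι-mono-≤ α≥0) (ι-mono-< β>0)))
    (ι-combination₂ A B X α β e₁ e₂)

-- Polygons in convex position, indexed cyclically by 0 … n-1

prev : ℕ → ℕ → ℕ
prev n zero = ℕ.pred n
prev n (suc i) = i

next : ℕ → ℕ → ℕ
next n i with suc i ℕ.≟ n
... | yes _ = 0
... | no _ = suc i

next-view : ∀ n i → (suc i ≡ n × next n i ≡ 0) ⊎ (suc i ≢ n × next n i ≡ suc i)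
next-view n i with suc i ℕ.≟ n
... | yes e = inj₁ (e , refl)
... | no ne = inj₂ (ne , refl)

<s∧≢⇒< : ∀ {a b} → a ℕ.< suc b → a ≢ b → a ℕ.< b
<s∧≢⇒< lt ne = ℕP.≤∧≢⇒< (ℕ.s≤s⁻¹ lt) ne

prev-< : ∀ {n i} → i ℕ.< n → prev n i ℕ.< n
prev-< {suc n} {zero} lt = ℕP.n<1+n n
prev-< {n} {suc i} lt = ℕP.<-trans (ℕP.n<1+n i) lt

next-< : ∀ {n i} → i ℕ.< n → next n i ℕ.< n
next-< {n} {i} lt with next-view n i
... | inj₁ (_ , s) rewrite s = ℕP.≤-<-trans ℕ.z≤n lt
... | inj₂ (ne , s) rewrite s = ℕP.≤∧≢⇒< lt ne

prev-next : ∀ {n j} → j ℕ.< n → prev n (next n j) ≡ j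
prev-next {n} {j} lt with next-view n j
... | inj₁ (e , s) rewrite s = cong ℕ.pred (sym e)
... | inj₂ (_ , s) rewrite s = refl

next-last : ∀ {n} → 1 ℕ.≤ n → next n (ℕ.pred n) ≡ 0
next-last {suc n} _ with next-view (suc n) n
... | inj₁ (_ , s) = s
... | inj₂ (ne , _) = ⊥-elim (ne refl)

next-mid : ∀ {n k} → suc k ℕ.< n → next n k ≡ suc k
next-mid {n} {k} lt with next-view n k
... | inj₁ (e , _) = ⊥-elim (ℕP.<-irrefl e lt)
... | inj₂ (_ , s) = s

prev≢ : ∀ {n i} → 2 ℕ.≤ n → i ℕ.< n → prev n i ≢ i
prev≢ {suc zero} {zero} (ℕ.s≤s ()) _
prev≢ {suc (suc m)} {zero} _ _ ()
prev≢ {n} {suc i} _ _ e = ℕP.1+n≢n (sym e)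

next≢ : ∀ {n i} → 2 ℕ.≤ n → i ℕ.< n → next n i ≢ i
next≢ {n} {i} n≥2 _ e with next-view n i
... | inj₁ (e′ , s) rewrite s = ℕP.<-irrefl (trans (cong suc e) e′) n≥2
... | inj₂ (_ , s) rewrite s = ℕP.1+n≢n e

prev≢next : ∀ {n i} → 3 ℕ.≤ n → i ℕ.< n → prev n i ≢ next n i
prev≢next {suc zero} (ℕ.s≤s ()) _
prev≢next {suc (suc zero)} (ℕ.s≤s (ℕ.s≤s ())) _
prev≢next {suc (suc (suc m))} {i} n≥3 _ e with next-view (suc (suc (suc m))) i
prev≢next {suc (suc (suc m))} {zero} _ _ e | inj₁ (() , _)
prev≢next {suc (suc (suc m))} {zero} _ _ e | inj₂ (_ , s) rewrite s = ℕP.1+n≢0 (cong ℕ.pred e)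
prev≢next {suc (suc (suc m))} {suc i} n≥3 _ e | inj₁ (e′ , s) rewrite s with e
... | refl = ℕP.<-irrefl e′ n≥3
prev≢next {suc (suc (suc m))} {suc i} _ _ e | inj₂ (_ , s) rewrite s =
  ℕP.<-irrefl e (ℕP.<-trans (ℕP.n<1+n i) (ℕP.n<1+n (suc i)))

Cyclic : ℕ → ℕ → ℕ → Set
Cyclic p q r = (p ℕ.< q × q ℕ.< r) ⊎ (q ℕ.< r × r ℕ.< p) ⊎ (r ℕ.< p × p ℕ.< q)

cyclic-rotate : ∀ {p q r} → Cyclic p q r → Cyclic q r p
cyclic-rotate (inj₁ (a , b)) = inj₂ (inj₂ (a , b))
cyclic-rotate (inj₂ (inj₁ (a , b))) = inj₁ (a , b)
cyclic-rotate (inj₂ (inj₂ (a , b))) = inj₂ (inj₁ (a , b))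

cyclic-prev : ∀ {n i y z} → i ℕ.< n → z ℕ.< n → Cyclic i y z → y ≢ prev n i → z ≢ prev n i → Cyclic (prev n i) y z
cyclic-prev {suc m} {zero} _ zl (inj₁ (_ , b)) _ nz = inj₂ (inj₁ (b , <s∧≢⇒< zl nz))
cyclic-prev {suc m} {zero} _ _ (inj₂ (inj₁ (_ , ())))
cyclic-prev {suc m} {zero} _ _ (inj₂ (inj₂ (() , _)))
cyclic-prev {n} {suc i} _ _ (inj₁ (a , b)) _ _ = inj₁ (ℕP.<-trans (ℕP.n<1+n i) a , b)
cyclic-prev {n} {suc i} _ _ (inj₂ (inj₁ (a , b))) _ nz = inj₂ (inj₁ (a , <s∧≢⇒< b nz))
cyclic-prev {n} {suc i} _ _ (inj₂ (inj₂ (a , b))) _ nz = inj₂ (inj₂ (<s∧≢⇒< a nz , ℕP.<-trans (ℕP.n<1+n i) b))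

cyclic-next : ∀ {n i y z} → i ℕ.< n → y ℕ.< n → Cyclic i y z → y ≢ next n i → z ≢ next n i → Cyclic (next n i) y z
cyclic-next {n} {i} {y} _ yl c ny nz with next-view n i
cyclic-next {n} {i} {y} _ yl (inj₁ (a , _)) _ _ | inj₁ (e , _) =
  ⊥-elim (ℕP.<-irrefl refl (ℕP.<-≤-trans yl (subst (ℕ._≤ y) e a)))
cyclic-next _ _ (inj₂ (inj₁ (a , _))) ny _ | inj₁ (_ , s) rewrite s = inj₁ (ℕP.n≢0⇒n>0 ny , a)
cyclic-next {n} {i} {y} _ yl (inj₂ (inj₂ (_ , b))) _ _ | inj₁ (e , _) =
  ⊥-elim (ℕP.<-irrefl refl (ℕP.<-≤-trans yl (subst (ℕ._≤ y) e b)))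
cyclic-next _ _ (inj₁ (a , b)) ny _ | inj₂ (_ , s) rewrite s = inj₁ (ℕP.≤∧≢⇒< a (λ e → ny (sym e)) , b)
cyclic-next {i = i} _ _ (inj₂ (inj₁ (a , b))) _ _ | inj₂ (_ , s) rewrite s = inj₂ (inj₁ (a , ℕP.<-trans b (ℕP.n<1+n i)))
cyclic-next {i = i} _ _ (inj₂ (inj₂ (a , b))) ny _ | inj₂ (_ , s) rewrite s =
  inj₂ (inj₂ (ℕP.<-trans a (ℕP.n<1+n i) , ℕP.≤∧≢⇒< b (λ e → ny (sym e))))

cyclic-prev-i-x : ∀ {n i x} → i ℕ.< n → x ℕ.< n → x ≢ i → x ≢ prev n i → Cyclic (prev n i) i x
cyclic-prev-i-x {suc m} {zero} _ xl nx np = inj₂ (inj₁ (ℕP.n≢0⇒n>0 nx , <s∧≢⇒< xl np))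
cyclic-prev-i-x {n} {suc i} {x} _ _ nx np with ℕP.<-cmp x (suc i)
... | tri< lt _ _ = inj₂ (inj₂ (<s∧≢⇒< lt np , ℕP.n<1+n i))
... | tri≈ _ e _ = ⊥-elim (nx e)
... | tri> _ _ gt = inj₁ (ℕP.n<1+n i , gt)

cyclic-i-next-x : ∀ {n i x} → i ℕ.< n → x ℕ.< n → x ≢ i → x ≢ next n i → Cyclic i (next n i) x
cyclic-i-next-x {n} {i} {x} _ xl nx ns with next-view n i
... | inj₁ (e , s) rewrite s = inj₂ (inj₁ (ℕP.n≢0⇒n>0 ns , <s∧≢⇒< (subst (x ℕ.<_) (sym e) xl) nx))
... | inj₂ (_ , s) rewrite s with ℕP.<-cmp x i
...   | tri< lt _ _ = inj₂ (inj₂ (lt , ℕP.n<1+n i))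
...   | tri≈ _ e _ = ⊥-elim (nx e)
...   | tri> _ _ gt = inj₁ (ℕP.n<1+n i , ℕP.≤∧≢⇒< gt (λ e → ns (sym e)))

cyclic-i-next-prev : ∀ {n i} → 3 ℕ.≤ n → i ℕ.< n → Cyclic i (next n i) (prev n i)
cyclic-i-next-prev n≥3 il = cyclic-i-next-x il (prev-< il) (prev≢ (ℕP.<⇒≤ n≥3) il) (prev≢next n≥3 il)

cyclic-prev-i-next : ∀ {n i} → 3 ℕ.≤ n → i ℕ.< n → Cyclic (prev n i) i (next n i)
cyclic-prev-i-next n≥3 il = cyclic-rotate (cyclic-rotate (cyclic-i-next-prev n≥3 il))

-- Every increasing triple is counterclockwise: w 0, …, w (n-1) are the vertices of a convex polygon,
-- in counterclockwise order.
ConvexPosition : ℕ → (ℕ → Lattice) → Set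
ConvexPosition n w = ∀ a b c → a ℕ.< b → b ℕ.< c → c ℕ.< n → + 0 <ᶻ det (w a) (w b) (w c)

convex-cyclic : ∀ {n w} → ConvexPosition n w → ∀ {p q r} → p ℕ.< n → q ℕ.< n → r ℕ.< n →
  Cyclic p q r → + 0 <ᶻ det (w p) (w q) (w r)
convex-cyclic cv {p} {q} {r} _ _ rl (inj₁ (a , b)) = cv p q r a b rl
convex-cyclic {w = w} cv {p} {q} {r} pl _ _ (inj₂ (inj₁ (a , b))) =
  subst (+ 0 <ᶻ_) (sym (det-cyclic (w p) (w q) (w r))) (cv q r p a b pl)
convex-cyclic {w = w} cv {p} {q} {r} _ ql _ (inj₂ (inj₂ (a , b))) =
  subst (+ 0 <ᶻ_) (det-cyclic (w r) (w p) (w q)) (cv r p q a b ql)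

convex-cyclic-nonNeg : ∀ {n w} → ConvexPosition n w → ∀ {m y z} → m ℕ.< n → y ℕ.< n → z ℕ.< n →
  (y ≢ m → z ≢ m → Cyclic m y z) → + 0 ≤ᶻ det (w m) (w y) (w z)
convex-cyclic-nonNeg {w = w} cv {m} {y} {z} ml yl zl h with y ℕ.≟ m | z ℕ.≟ m
... | yes refl | _ = ℤP.≤-reflexive (sym (det-aab (w y) (w z)))
... | no _ | yes refl = ℤP.≤-reflexive (sym (det-aba (w z) (w y)))
... | no ny | no nz = ℤP.<⇒≤ (convex-cyclic {w = w} cv ml yl zl (h ny nz))

_[_]≔_ : (ℕ → Lattice) → ℕ → Lattice → ℕ → Lattice
(w [ i ]≔ x) j with j ℕ.≟ i
... | yes _ = x
... | no _ = w j

[]≔-updates : ∀ w i x → (w [ i ]≔ x) i ≡ x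
[]≔-updates w i x with i ℕ.≟ i
... | yes _ = refl
... | no ne = ⊥-elim (ne refl)

[]≔-minimal : ∀ w i x j → j ≢ i → (w [ i ]≔ x) j ≡ w j
[]≔-minimal w i x j ne with j ℕ.≟ i
... | yes e = ⊥-elim (ne e)
... | no _ = refl

module ReplaceVertex {n w} (cv : ConvexPosition n w) (n≥3 : 3 ℕ.≤ n) {i} (i<n : i ℕ.< n) (X : Lattice)
  (α≥0 : + 0 ≤ᶻ det X (w i) (w (next n i))) (β>0 : + 0 <ᶻ det (w (prev n i)) X (w (next n i)))
  (γ≥0 : + 0 ≤ᶻ det (w (prev n i)) (w i) X) where

  -- X lies in the triangle spanned by w i and its two neighbours, so det X y z is a nonnegative
  -- combination of det A y z, det B y z, det C y z with positive weight on the positive term det B y z.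
  det-pos : ∀ {y z} → y ℕ.< n → z ℕ.< n → y ≢ i → z ≢ i → Cyclic i y z → + 0 <ᶻ det X (w y) (w z)
  det-pos {y} {z} yl zl ny nz c =
    *-cancel-posᶻ ABC>0 (subst (+ 0 <ᶻ_) (sym (det-barycentric A B C X (w y) (w z)))
      (ℤP.+-mono-<-≤ (ℤP.+-mono-≤-< (*-nonNegᶻ α≥0 Ayz≥0) (*-posᶻ β>0 Byz>0)) (*-nonNegᶻ γ≥0 Cyz≥0)))
    where
    A = w (prev n i)
    B = w i
    C = w (next n i)
    ABC>0 : + 0 <ᶻ det A B C
    ABC>0 = convex-cyclic {w = w} cv (prev-< i<n) i<n (next-< i<n) (cyclic-prev-i-next n≥3 i<n)
    Ayz≥0 : + 0 ≤ᶻ det A (w y) (w z)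
    Ayz≥0 = convex-cyclic-nonNeg {w = w} cv (prev-< i<n) yl zl (cyclic-prev i<n zl c)
    Byz>0 : + 0 <ᶻ det B (w y) (w z)
    Byz>0 = convex-cyclic {w = w} cv i<n yl zl c
    Cyz≥0 : + 0 ≤ᶻ det C (w y) (w z)
    Cyz≥0 = convex-cyclic-nonNeg {w = w} cv (next-< i<n) yl zl (cyclic-next i<n yl c)

  w′ : ℕ → Lattice
  w′ = w [ i ]≔ X

  preserves-convexity : ConvexPosition n w′
  preserves-convexity a b c a<b b<c c<n = go (a ℕ.≟ i) (b ℕ.≟ i) (c ℕ.≟ i)
    where
    b<n = ℕP.<-trans b<c c<n
    a<n = ℕP.<-trans a<b b<n
    b≢a : b ≢ a
    b≢a e = ℕP.<-irrefl (sym e) a<b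
    c≢a : c ≢ a
    c≢a e = ℕP.<-irrefl (sym e) (ℕP.<-trans a<b b<c)
    c≢b : c ≢ b
    c≢b e = ℕP.<-irrefl (sym e) b<c
    upd = []≔-updates w i X
    keep = []≔-minimal w i X
    det-cong : ∀ {a a′ b b′ c c′} → a ≡ a′ → b ≡ b′ → c ≡ c′ → det a b c ≡ det a′ b′ c′
    det-cong refl refl refl = refl
    go : Dec (a ≡ i) → Dec (b ≡ i) → Dec (c ≡ i) → + 0 <ᶻ det (w′ a) (w′ b) (w′ c)
    go (yes refl) _ _ = subst (+ 0 <ᶻ_) (sym (det-cong upd (keep b b≢a) (keep c c≢a)))
      (det-pos b<n c<n b≢a c≢a (inj₁ (a<b , b<c)))
    go (no a≢i) (yes refl) _ =
      subst (+ 0 <ᶻ_) (sym (trans (det-cong (keep a a≢i) upd (keep c c≢b)) (det-cyclic (w a) X (w c))))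
        (det-pos c<n a<n c≢b a≢i (inj₂ (inj₂ (a<b , b<c))))
    go (no a≢i) (no b≢i) (yes refl) =
      subst (+ 0 <ᶻ_) (sym (trans (det-cong (keep a a≢i) (keep b b≢i) upd)
                                  (trans (det-cyclic (w a) (w b) X) (det-cyclic (w b) X (w a)))))
        (det-pos a<n b<n a≢i b≢i (inj₂ (inj₁ (a<b , b<c))))
    go (no a≢i) (no b≢i) (no c≢i) =
      subst (+ 0 <ᶻ_) (sym (det-cong (keep a a≢i) (keep b b≢i) (keep c c≢i))) (cv a b c a<b b<c c<n)

-- Primitive vectors

-- gcd (d₁ , d₂) = 1, in Bézout form.
Primitive : Lattice → Set
Primitive (d₁ , d₂) = Σ ℤ λ u → Σ ℤ λ v → u *ᶻ d₁ +ᶻ v *ᶻ d₂ ≡ + 1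

PrimitiveEdge : Lattice → Lattice → Set
PrimitiveEdge a b = Primitive (b ⊖ a)

primitive-edge-sym : ∀ {a b} → PrimitiveEdge a b → PrimitiveEdge b a
primitive-edge-sym {a₁ , a₂} {b₁ , b₂} (u , v , e) = -ᶻ u , -ᶻ v , trans flip e
  where
  flip : -ᶻ u *ᶻ (a₁ -ᶻ b₁) +ᶻ -ᶻ v *ᶻ (a₂ -ᶻ b₂) ≡ u *ᶻ (b₁ -ᶻ a₁) +ᶻ v *ᶻ (b₂ -ᶻ a₂)
  flip = ZR.solve 6 (λ u v a₁ a₂ b₁ b₂ → :- u :* (a₁ :- b₁) :+ :- v :* (a₂ :- b₂) := u :* (b₁ :- a₁) :+ v :* (b₂ :- a₂))
           refl u v a₁ a₂ b₁ b₂
    where open ZR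

¬primitive-0 : ¬ Primitive (+ 0 , + 0)
¬primitive-0 (u , v , e) with trans (sym (cong₂ _+ᶻ_ (ℤP.*-zeroʳ u) (ℤP.*-zeroʳ v))) e
... | ()

private
  signed-abs : ∀ i → Σ ℤ λ s → (s *ᶻ s ≡ + 1) × (i ≡ s *ᶻ + ℤ.∣ i ∣)
  signed-abs (+ n) = + 1 , refl , sym (ℤP.*-identityˡ (+ n))
  signed-abs -[1+ n ] = -[1+ 0 ] , refl , sym (ℤP.-1*i≡-i (+ suc n))

  bézout-signed : ∀ (s t : ℤ) (a b : ℕ) → s *ᶻ s ≡ + 1 → t *ᶻ t ≡ + 1 → GCD.Bézout.Identity 1 a b →
    Primitive (s *ᶻ + a , t *ᶻ + b)
  bézout-signed s t a b ss tt (GCD.Bézout.+- x y eq) = + x *ᶻ s , -ᶻ (+ y) *ᶻ t , (begin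
    + x *ᶻ s *ᶻ (s *ᶻ + a) +ᶻ -ᶻ (+ y) *ᶻ t *ᶻ (t *ᶻ + b)
      ≡⟨ ZR.solve 6 (λ x y s t a b → x :* s :* (s :* a) :+ :- y :* t :* (t :* b) := x :* a :* (s :* s) :- y :* b :* (t :* t))
           refl (+ x) (+ y) s t (+ a) (+ b) ⟩
    + x *ᶻ + a *ᶻ (s *ᶻ s) -ᶻ + y *ᶻ + b *ᶻ (t *ᶻ t)
      ≡⟨ cong₂ (λ σ τ → + x *ᶻ + a *ᶻ σ -ᶻ + y *ᶻ + b *ᶻ τ) ss tt ⟩
    + x *ᶻ + a *ᶻ + 1 -ᶻ + y *ᶻ + b *ᶻ + 1
      ≡⟨ cong (λ r → r *ᶻ + 1 -ᶻ + y *ᶻ + b *ᶻ + 1) (trans (sym (ℤP.pos-* x a)) (cong +_ (sym eq))) ⟩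
    + (1 ℕ.+ y ℕ.* b) *ᶻ + 1 -ᶻ + y *ᶻ + b *ᶻ + 1
      ≡⟨ cong (λ r → r *ᶻ + 1 -ᶻ + y *ᶻ + b *ᶻ + 1) (trans (ℤP.pos-+ 1 (y ℕ.* b)) (cong (+ 1 +ᶻ_) (ℤP.pos-* y b))) ⟩
    (+ 1 +ᶻ + y *ᶻ + b) *ᶻ + 1 -ᶻ + y *ᶻ + b *ᶻ + 1
      ≡⟨ ZR.solve 1 (λ r → (con (+ 1) :+ r) :* con (+ 1) :- r :* con (+ 1) := con (+ 1)) refl (+ y *ᶻ + b) ⟩
    + 1 ∎)
    where
    open ≡-Reasoning
    open ZR using (_:+_; _:*_; _:-_; :-_; _:=_; con)
  bézout-signed s t a b ss tt (GCD.Bézout.-+ x y eq) with bézout-signed t s b a tt ss (GCD.Bézout.+- y x eq)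
  ... | u , v , e = v , u , trans (ℤP.+-comm (v *ᶻ (s *ᶻ + a)) (u *ᶻ (t *ᶻ + b))) e

primitive-decomposition : ∀ d → d ≢ (+ 0 , + 0) → Σ ℕ λ g′ → Σ Lattice λ q → Primitive q × d ≡ scale (suc g′) q
primitive-decomposition (d₁ , d₂) d≢0 = ℕ.pred g , q , prim , d≡
  where
  m = ℤ.∣ d₁ ∣
  n = ℤ.∣ d₂ ∣
  g = gcd m n
  g≢0 : g ≢ 0
  g≢0 g≡0 = d≢0 (cong₂ _,_ (ℤP.∣i∣≡0⇒i≡0 (gcd[m,n]≡0⇒m≡0 g≡0)) (ℤP.∣i∣≡0⇒i≡0 (gcd[m,n]≡0⇒n≡0 m g≡0)))
  instance
    g-nonZero : ℕ.NonZero g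
    g-nonZero = ℕ.≢-nonZero g≢0
  s₁ = proj₁ (signed-abs d₁)
  s₂ = proj₁ (signed-abs d₂)
  q = (s₁ *ᶻ + (m / g) , s₂ *ᶻ + (n / g))
  prim : Primitive q
  prim = bézout-signed s₁ s₂ (m / g) (n / g) (proj₁ (proj₂ (signed-abs d₁))) (proj₁ (proj₂ (signed-abs d₂)))
           (coprime-Bézout (coprime-/gcd m n))
  undivide : ∀ (s : ℤ) k → g ∣ℕ k → s *ᶻ + k ≡ s *ᶻ + (k / g) *ᶻ + suc (ℕ.pred g)
  undivide s k g∣k = begin
    s *ᶻ + k                                ≡⟨ cong (λ r → s *ᶻ + r) (sym (m/n*n≡m g∣k)) ⟩
    s *ᶻ + (k / g ℕ.* g)                    ≡⟨ cong (s *ᶻ_) (ℤP.pos-* (k / g) g) ⟩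
    s *ᶻ (+ (k / g) *ᶻ + g)                 ≡⟨ ℤP.*-assoc s (+ (k / g)) (+ g) ⟨
    s *ᶻ + (k / g) *ᶻ + g                   ≡⟨ cong (λ r → s *ᶻ + (k / g) *ᶻ + r) (ℕP.suc-pred g) ⟨
    s *ᶻ + (k / g) *ᶻ + suc (ℕ.pred g)      ∎
    where open ≡-Reasoning
  d≡ : (d₁ , d₂) ≡ scale (suc (ℕ.pred g)) q
  d≡ = cong₂ _,_ (trans (proj₂ (proj₂ (signed-abs d₁))) (undivide s₁ m (gcd[m,n]∣m m n)))
                 (trans (proj₂ (proj₂ (signed-abs d₂))) (undivide s₂ n (gcd[m,n]∣n m n)))

private
  module DescentIdentities (g : ℕ) where
    open ZR using (solve; _:+_; _:*_; _:-_; _:=_; con)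
    G : ℕ
    G = suc (suc g)

    toward-A-AXC : ∀ A C q → + G *ᶻ det A (A ⊞ q) C ≡ det A (A ⊞ scale G q) C
    toward-A-AXC (a₁ , a₂) (c₁ , c₂) (q₁ , q₂) = solve 7 (λ a₁ a₂ c₁ c₂ q₁ q₂ h →
      (con (+ 1) :+ h) :* detᶻᴾ a₁ a₂ (a₁ :+ q₁) (a₂ :+ q₂) c₁ c₂ :=
      detᶻᴾ a₁ a₂ (a₁ :+ q₁ :* (con (+ 1) :+ h)) (a₂ :+ q₂ :* (con (+ 1) :+ h)) c₁ c₂) refl a₁ a₂ c₁ c₂ q₁ q₂ (+ suc g)

    toward-A-XBC : ∀ A B C q → + G *ᶻ det (A ⊞ q) B C ≡ det (A ⊞ scale G q) B C +ᶻ + suc g *ᶻ det A B C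
    toward-A-XBC (a₁ , a₂) (b₁ , b₂) (c₁ , c₂) (q₁ , q₂) = solve 9 (λ a₁ a₂ b₁ b₂ c₁ c₂ q₁ q₂ h →
      (con (+ 1) :+ h) :* detᶻᴾ (a₁ :+ q₁) (a₂ :+ q₂) b₁ b₂ c₁ c₂ :=
      detᶻᴾ (a₁ :+ q₁ :* (con (+ 1) :+ h)) (a₂ :+ q₂ :* (con (+ 1) :+ h)) b₁ b₂ c₁ c₂ :+ h :* detᶻᴾ a₁ a₂ b₁ b₂ c₁ c₂)
      refl a₁ a₂ b₁ b₂ c₁ c₂ q₁ q₂ (+ suc g)

    toward-A-ABX : ∀ A B q → + G *ᶻ det A B (A ⊞ q) ≡ det A B (A ⊞ scale G q)
    toward-A-ABX (a₁ , a₂) (b₁ , b₂) (q₁ , q₂) = solve 7 (λ a₁ a₂ b₁ b₂ q₁ q₂ h →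
      (con (+ 1) :+ h) :* detᶻᴾ a₁ a₂ b₁ b₂ (a₁ :+ q₁) (a₂ :+ q₂) :=
      detᶻᴾ a₁ a₂ b₁ b₂ (a₁ :+ q₁ :* (con (+ 1) :+ h)) (a₂ :+ q₂ :* (con (+ 1) :+ h))) refl a₁ a₂ b₁ b₂ q₁ q₂ (+ suc g)

    toward-C-AXC : ∀ A C q → + G *ᶻ det A (C ⊞ q) C ≡ det A (C ⊞ scale G q) C
    toward-C-AXC (a₁ , a₂) (c₁ , c₂) (q₁ , q₂) = solve 7 (λ a₁ a₂ c₁ c₂ q₁ q₂ h →
      (con (+ 1) :+ h) :* detᶻᴾ a₁ a₂ (c₁ :+ q₁) (c₂ :+ q₂) c₁ c₂ :=
      detᶻᴾ a₁ a₂ (c₁ :+ q₁ :* (con (+ 1) :+ h)) (c₂ :+ q₂ :* (con (+ 1) :+ h)) c₁ c₂) refl a₁ a₂ c₁ c₂ q₁ q₂ (+ suc g)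

    toward-C-XBC : ∀ B C q → + G *ᶻ det (C ⊞ q) B C ≡ det (C ⊞ scale G q) B C
    toward-C-XBC (b₁ , b₂) (c₁ , c₂) (q₁ , q₂) = solve 7 (λ b₁ b₂ c₁ c₂ q₁ q₂ h →
      (con (+ 1) :+ h) :* detᶻᴾ (c₁ :+ q₁) (c₂ :+ q₂) b₁ b₂ c₁ c₂ :=
      detᶻᴾ (c₁ :+ q₁ :* (con (+ 1) :+ h)) (c₂ :+ q₂ :* (con (+ 1) :+ h)) b₁ b₂ c₁ c₂) refl b₁ b₂ c₁ c₂ q₁ q₂ (+ suc g)

    toward-C-ABX : ∀ A B C q → + G *ᶻ det A B (C ⊞ q) ≡ det A B (C ⊞ scale G q) +ᶻ + suc g *ᶻ det A B C
    toward-C-ABX (a₁ , a₂) (b₁ , b₂) (c₁ , c₂) (q₁ , q₂) = solve 9 (λ a₁ a₂ b₁ b₂ c₁ c₂ q₁ q₂ h →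
      (con (+ 1) :+ h) :* detᶻᴾ a₁ a₂ b₁ b₂ (c₁ :+ q₁) (c₂ :+ q₂) :=
      detᶻᴾ a₁ a₂ b₁ b₂ (c₁ :+ q₁ :* (con (+ 1) :+ h)) (c₂ :+ q₂ :* (con (+ 1) :+ h)) :+ h :* detᶻᴾ a₁ a₂ b₁ b₂ c₁ c₂)
      refl a₁ a₂ b₁ b₂ c₁ c₂ q₁ q₂ (+ suc g)

  divided-bound : ∀ {h f} g → + 0 <ᶻ h → + suc (suc g) *ᶻ h ≤ᶻ + suc f → h ≤ᶻ + f
  divided-bound {h} {f} g h>0 le = ℤP.i<j⇒i≤pred[j] (ℤP.<-≤-trans h<h+h (ℤP.≤-trans h+h≤Gh le))
    where
    h<h+h : h <ᶻ h +ᶻ h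
    h<h+h = subst (_<ᶻ h +ᶻ h) (ℤP.+-identityʳ h) (ℤP.+-monoʳ-< h h>0)
    h+h≤Gh : h +ᶻ h ≤ᶻ + suc (suc g) *ᶻ h
    h+h≤Gh = subst (_≤ᶻ + suc (suc g) *ᶻ h) (ZR.solve 1 (λ h → (con (+ 2)) :* h := h :+ h) refl h)
               (ℤP.*-monoʳ-≤-nonNeg h {{ℤ.nonNegative (ℤP.<⇒≤ h>0)}} (ℤ.+≤+ {2} {suc (suc g)} (ℕ.s≤s (ℕ.s≤s ℕ.z≤n))))
      where open ZR

-- Starting from X = B, while an edge A X or X C is not primitive, say X - A = g q with g ≥ 2,
-- move X to A + q. This stays in the triangle A B C and divides det A X C by g, so it terminates.
module TriangleDescent (A B C : Lattice) (ABC>0 : + 0 <ᶻ det A B C) where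

  InTriangle : Lattice → Set
  InTriangle X = (+ 0 ≤ᶻ det X B C) × (+ 0 <ᶻ det A X C) × (+ 0 ≤ᶻ det A B X)

  Result : Set
  Result = Σ Lattice λ X → InTriangle X × PrimitiveEdge A X × PrimitiveEdge X C

  private
    ≢corner : ∀ {X} P → det A P C ≡ + 0 → InTriangle X → X ⊖ P ≢ (+ 0 , + 0)
    ≢corner {X} P APC≡0 (_ , AXC>0 , _) X-P≡0 =
      ℤP.<-irrefl (sym (trans (cong (λ Y → det A Y C) (⊖≡0⇒≡ X P X-P≡0)) APC≡0)) AXC>0

  toward-A : ∀ {X} g q → X ≡ A ⊞ scale (suc (suc g)) q → InTriangle X →
    InTriangle (A ⊞ q) × (+ suc (suc g) *ᶻ det A (A ⊞ q) C ≡ det A X C)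
  toward-A g q refl (XBC≥0 , AXC>0 , ABX≥0) =
    ( *-cancel-nonNegᶻ G>0 (subst (+ 0 ≤ᶻ_) (sym (toward-A-XBC A B C q))
        (ℤP.+-mono-≤ XBC≥0 (*-nonNegᶻ {+ suc g} (ℤ.+≤+ ℕ.z≤n) (ℤP.<⇒≤ ABC>0))))
    , *-cancel-posᶻ G>0 (subst (+ 0 <ᶻ_) (sym (toward-A-AXC A C q)) AXC>0)
    , *-cancel-nonNegᶻ G>0 (subst (+ 0 ≤ᶻ_) (sym (toward-A-ABX A B q)) ABX≥0) )
    , toward-A-AXC A C q
    where
    open DescentIdentities g
    G>0 : + 0 <ᶻ + G
    G>0 = ℤ.+<+ (ℕ.s≤s ℕ.z≤n)

  toward-C : ∀ {X} g q → X ≡ C ⊞ scale (suc (suc g)) q → InTriangle X →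
    InTriangle (C ⊞ q) × (+ suc (suc g) *ᶻ det A (C ⊞ q) C ≡ det A X C)
  toward-C g q refl (XBC≥0 , AXC>0 , ABX≥0) =
    ( *-cancel-nonNegᶻ G>0 (subst (+ 0 ≤ᶻ_) (sym (toward-C-XBC B C q)) XBC≥0)
    , *-cancel-posᶻ G>0 (subst (+ 0 <ᶻ_) (sym (toward-C-AXC A C q)) AXC>0)
    , *-cancel-nonNegᶻ G>0 (subst (+ 0 ≤ᶻ_) (sym (toward-C-ABX A B C q))
        (ℤP.+-mono-≤ ABX≥0 (*-nonNegᶻ {+ suc g} (ℤ.+≤+ ℕ.z≤n) (ℤP.<⇒≤ ABC>0)))) )
    , toward-C-AXC A C q
    where
    open DescentIdentities g
    G>0 : + 0 <ᶻ + G
    G>0 = ℤ.+<+ (ℕ.s≤s ℕ.z≤n)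

  descend : (f : ℕ) (X : Lattice) → InTriangle X → det A X C ≤ᶻ + f → Result
  descend zero X (_ , AXC>0 , _) le = ⊥-elim (ℤP.<-irrefl refl (ℤP.<-≤-trans AXC>0 le))
  descend (suc f) X inX le = from-A (primitive-decomposition (X ⊖ A) (≢corner A (det-aab A C) inX))
    where
    from-C : PrimitiveEdge A X → (Σ ℕ λ g′ → Σ Lattice λ q → Primitive q × X ⊖ C ≡ scale (suc g′) q) → Result
    from-C primA (suc g , q , _ , X-C≡) with toward-C g q (trans (⊖-⊞ C X) (cong (C ⊞_) X-C≡)) inX
    ... | inX′ , e = descend f (C ⊞ q) inX′ (divided-bound g (proj₁ (proj₂ inX′)) (subst (_≤ᶻ + suc f) (sym e) le))
    from-C primA (zero , q , primC , X-C≡) =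
      X , inX , primA , primitive-edge-sym {C} {X} (subst Primitive (sym (trans X-C≡ (scale-1 q))) primC)

    from-A : (Σ ℕ λ g′ → Σ Lattice λ q → Primitive q × X ⊖ A ≡ scale (suc g′) q) → Result
    from-A (suc g , q , _ , X-A≡) with toward-A g q (trans (⊖-⊞ A X) (cong (A ⊞_) X-A≡)) inX
    ... | inX′ , e = descend f (A ⊞ q) inX′ (divided-bound g (proj₁ (proj₂ inX′)) (subst (_≤ᶻ + suc f) (sym e) le))
    from-A (zero , q , primA , X-A≡) =
      from-C (subst Primitive (sym (trans X-A≡ (scale-1 q))) primA) (primitive-decomposition (X ⊖ C) (≢corner C (det-abb A C) inX))

  primitive-point : Result
  primitive-point = descend ℤ.∣ det A B C ∣ B
    (ℤP.≤-reflexive (sym (det-aab B C)) , ABC>0 , ℤP.≤-reflexive (sym (det-abb A B)))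
    (ℤP.≤-reflexive (sym (ℤP.0≤i⇒+∣i∣≡i (ℤP.<⇒≤ ABC>0))))

private
  bézout-parameter : ∀ (a₁ a₂ b₁ b₂ z₁ z₂ u v l₀ l : ℚ) → z₁ ≡ l₀ * a₁ + l * b₁ → z₂ ≡ l₀ * a₂ + l * b₂ →
    l₀ + l ≡ 1ℚ → u * (b₁ - a₁) + v * (b₂ - a₂) ≡ 1ℚ → u * (z₁ - a₁) + v * (z₂ - a₂) ≡ l
  bézout-parameter a₁ a₂ b₁ b₂ z₁ z₂ u v l₀ l refl refl l₀+l≡1 uv≡1 = begin
    u * ((l₀ * a₁ + l * b₁) - a₁) + v * ((l₀ * a₂ + l * b₂) - a₂)
      ≡⟨ cong (λ t → u * ((t * a₁ + l * b₁) - a₁) + v * ((t * a₂ + l * b₂) - a₂)) l₀≡ ⟩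
    u * (((1ℚ - l) * a₁ + l * b₁) - a₁) + v * (((1ℚ - l) * a₂ + l * b₂) - a₂)
      ≡⟨ QR.solve 7 (λ a₁ a₂ b₁ b₂ u v l →
           u :* (((con 1ℚ :- l) :* a₁ :+ l :* b₁) :- a₁) :+ v :* (((con 1ℚ :- l) :* a₂ :+ l :* b₂) :- a₂)
           := l :* (u :* (b₁ :- a₁) :+ v :* (b₂ :- a₂))) refl a₁ a₂ b₁ b₂ u v l ⟩
    l * (u * (b₁ - a₁) + v * (b₂ - a₂))  ≡⟨ cong (l *_) uv≡1 ⟩
    l * 1ℚ                               ≡⟨ ℚP.*-identityʳ l ⟩
    l                                    ∎
    where
    open ≡-Reasoning
    open QR using (_:+_; _:*_; _:-_; _:=_; con)
    l₀≡ : l₀ ≡ 1ℚ - l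
    l₀≡ = trans (QR.solve 2 (λ a b → a := (a :+ b) :- b) refl l₀ l) (cong (_- l) l₀+l≡1)

  0≤i≤1 : ∀ (m : ℤ) → + 0 ≤ᶻ m → m ≤ᶻ + 1 → m ≡ + 0 ⊎ m ≡ + 1
  0≤i≤1 (+ 0) _ _ = inj₁ refl
  0≤i≤1 (+ 1) _ _ = inj₂ refl
  0≤i≤1 (+ suc (suc k)) _ (ℤ.+≤+ (ℕ.s≤s ()))

  ·-zero-⊕ : ∀ (p q : Pt) → (1ℚ · p) ⊕ (0ℚ · q) ≡ p
  ·-zero-⊕ (p₁ , p₂) (q₁ , q₂) = cong₂ _,_ (QR.solve 2 (λ p q → con 1ℚ :* p :+ con 0ℚ :* q := p) refl p₁ q₁)
                                              (QR.solve 2 (λ p q → con 1ℚ :* p :+ con 0ℚ :* q := p) refl p₂ q₂)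
    where open QR

  zero-·-⊕ : ∀ (p q : Pt) → (0ℚ · p) ⊕ (1ℚ · q) ≡ q
  zero-·-⊕ (p₁ , p₂) (q₁ , q₂) = cong₂ _,_ (QR.solve 2 (λ p q → con 0ℚ :* p :+ con 1ℚ :* q := q) refl p₁ q₁)
                                              (QR.solve 2 (λ p q → con 0ℚ :* p :+ con 1ℚ :* q := q) refl p₂ q₂)
    where open QR

-- Pairing with the Bézout coefficients of B - A turns the weight of B into the integer
-- u (z₁ - A₁) + v (z₂ - A₂), which lies in [0, 1].
primitive-edge-endpoints : ∀ (A B z : Lattice) (l₀ l₁ : ℚ) → 0ℚ ≤ l₀ → 0ℚ ≤ l₁ → l₀ + l₁ ≡ 1ℚ →
  embed z ≡ (l₀ · embed A) ⊕ (l₁ · embed B) → PrimitiveEdge A B → z ≡ A ⊎ z ≡ B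
primitive-edge-endpoints A@(a₁ , a₂) B@(b₁ , b₂) z@(z₁ , z₂) l₀ l₁ l₀≥0 l₁≥0 l₀+l₁≡1 z≡ (u , v , uv≡1) =
  endpoint (0≤i≤1 m (ι-cancel-≤ (ℚP.≤-trans l₁≥0 (ℚP.≤-reflexive (sym ιm≡l₁))))
                    (ι-cancel-≤ (ℚP.≤-trans (ℚP.≤-reflexive ιm≡l₁) l₁≤1)))
  where
  m = u *ᶻ (z₁ -ᶻ a₁) +ᶻ v *ᶻ (z₂ -ᶻ a₂)
  ι-pairing : ∀ x₁ x₂ → ι (u *ᶻ (x₁ -ᶻ a₁) +ᶻ v *ᶻ (x₂ -ᶻ a₂)) ≡ ι u * (ι x₁ - ι a₁) + ι v * (ι x₂ - ι a₂)
  ι-pairing x₁ x₂ = trans (ι-homo-+ (u *ᶻ (x₁ -ᶻ a₁)) (v *ᶻ (x₂ -ᶻ a₂)))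
    (cong₂ _+_ (trans (ι-homo-* u _) (cong (ι u *_) (ι-homo-sub x₁ a₁))) (trans (ι-homo-* v _) (cong (ι v *_) (ι-homo-sub x₂ a₂))))
  ιm≡l₁ : ι m ≡ l₁
  ιm≡l₁ = trans (ι-pairing z₁ z₂) (bézout-parameter (ι a₁) (ι a₂) (ι b₁) (ι b₂) (ι z₁) (ι z₂) (ι u) (ι v) l₀ l₁
            (cong proj₁ z≡) (cong proj₂ z≡) l₀+l₁≡1 (trans (sym (ι-pairing b₁ b₂)) (cong ι uv≡1)))
  l₁≤1 : l₁ ≤ 1ℚ
  l₁≤1 = ℚP.≤-trans (ℚP.≤-trans (ℚP.≤-reflexive (sym (ℚP.+-identityˡ l₁))) (ℚP.+-monoˡ-≤ l₁ l₀≥0))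
                    (ℚP.≤-reflexive l₀+l₁≡1)
  endpoint : m ≡ + 0 ⊎ m ≡ + 1 → z ≡ A ⊎ z ≡ B
  endpoint (inj₁ m≡0) = inj₁ (embed-injective (trans z≡ (trans (cong₂ (λ a b → (a · embed A) ⊕ (b · embed B)) l₀≡1 l₁≡0)
                                                                  (·-zero-⊕ (embed A) (embed B)))))
    where
    l₁≡0 : l₁ ≡ 0ℚ
    l₁≡0 = trans (sym ιm≡l₁) (cong ι m≡0)
    l₀≡1 : l₀ ≡ 1ℚ
    l₀≡1 = trans (sym (ℚP.+-identityʳ l₀)) (trans (cong (λ t → l₀ + t) (sym l₁≡0)) l₀+l₁≡1)
  endpoint (inj₂ m≡1) = inj₂ (embed-injective (trans z≡ (trans (cong₂ (λ a b → (a · embed A) ⊕ (b · embed B)) l₀≡0 l₁≡1)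
                                                                  (zero-·-⊕ (embed A) (embed B)))))
    where
    l₁≡1 : l₁ ≡ 1ℚ
    l₁≡1 = trans (sym ιm≡l₁) (cong ι m≡1)
    l₀≡0 : l₀ ≡ 0ℚ
    l₀≡0 = trans (+≡⇒≡- {l₁} (trans (ℚP.+-comm l₁ l₀) l₀+l₁≡1)) (trans (cong (λ t → 1ℚ - t) l₁≡1) (ℚP.+-inverseʳ 1ℚ))

det-functional : Pt → Pt → Affine
det-functional (a₁ , a₂) (b₁ , b₂) = (- (b₁ - a₁) * a₂ + (b₂ - a₂) * a₁) , - (b₂ - a₂) , (b₁ - a₁)

ev-det-functional : ∀ a b c → ev (det-functional a b) c ≡ detℚ a b c
ev-det-functional (a₁ , a₂) (b₁ , b₂) (c₁ , c₂) = QR.solve 6 (λ a₁ a₂ b₁ b₂ c₁ c₂ →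
  (:- (b₁ :- a₁) :* a₂ :+ (b₂ :- a₂) :* a₁) :+ (:- (b₂ :- a₂) :* c₁ :+ (b₁ :- a₁) :* c₂) := detℚᴾ a₁ a₂ b₁ b₂ c₁ c₂)
  refl a₁ a₂ b₁ b₂ c₁ c₂
  where open QR

detℚ-swap₁₂ : ∀ a b c → detℚ b a c ≡ - detℚ a b c
detℚ-swap₁₂ (a₁ , a₂) (b₁ , b₂) (c₁ , c₂) =
  QR.solve 6 (λ a₁ a₂ b₁ b₂ c₁ c₂ → detℚᴾ b₁ b₂ a₁ a₂ c₁ c₂ := :- detℚᴾ a₁ a₂ b₁ b₂ c₁ c₂)
    refl a₁ a₂ b₁ b₂ c₁ c₂
  where open QR

detℚ-shift : ∀ a b z y →
  detℚ a b y ≡ detℚ a b z - ((proj₁ b - proj₁ a) * (proj₂ z - proj₂ y) - (proj₂ b - proj₂ a) * (proj₁ z - proj₁ y))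
detℚ-shift (a₁ , a₂) (b₁ , b₂) (z₁ , z₂) (y₁ , y₂) = QR.solve 8 (λ a₁ a₂ b₁ b₂ z₁ z₂ y₁ y₂ →
  detℚᴾ a₁ a₂ b₁ b₂ y₁ y₂ := detℚᴾ a₁ a₂ b₁ b₂ z₁ z₂ :- ((b₁ :- a₁) :* (z₂ :- y₂) :- (b₂ :- a₂) :* (z₁ :- y₁)))
  refl a₁ a₂ b₁ b₂ z₁ z₂ y₁ y₂
  where open QR

detℚ-barycentric : ∀ (a b c y : Pt) → ((detℚ b c y + - detℚ a c y) + detℚ a b y) · y ≡
  ((detℚ b c y · a) ⊕ ((- detℚ a c y) · b)) ⊕ (detℚ a b y · c)
detℚ-barycentric (a₁ , a₂) (b₁ , b₂) (c₁ , c₂) (y₁ , y₂) = cong₂ _,_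
  (QR.solve 8 (λ a₁ a₂ b₁ b₂ c₁ c₂ y₁ y₂ →
    ((detℚᴾ b₁ b₂ c₁ c₂ y₁ y₂ :+ :- detℚᴾ a₁ a₂ c₁ c₂ y₁ y₂) :+ detℚᴾ a₁ a₂ b₁ b₂ y₁ y₂) :* y₁ :=
    (detℚᴾ b₁ b₂ c₁ c₂ y₁ y₂ :* a₁ :+ (:- detℚᴾ a₁ a₂ c₁ c₂ y₁ y₂) :* b₁)
      :+ detℚᴾ a₁ a₂ b₁ b₂ y₁ y₂ :* c₁)
    refl a₁ a₂ b₁ b₂ c₁ c₂ y₁ y₂)
  (QR.solve 8 (λ a₁ a₂ b₁ b₂ c₁ c₂ y₁ y₂ →
    ((detℚᴾ b₁ b₂ c₁ c₂ y₁ y₂ :+ :- detℚᴾ a₁ a₂ c₁ c₂ y₁ y₂) :+ detℚᴾ a₁ a₂ b₁ b₂ y₁ y₂) :* y₂ :=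
    (detℚᴾ b₁ b₂ c₁ c₂ y₁ y₂ :* a₂ :+ (:- detℚᴾ a₁ a₂ c₁ c₂ y₁ y₂) :* b₂)
      :+ detℚᴾ a₁ a₂ b₁ b₂ y₁ y₂ :* c₂)
    refl a₁ a₂ b₁ b₂ c₁ c₂ y₁ y₂)
  where open QR

detℚ-barycentric-sum : ∀ (a b c y : Pt) → (detℚ b c y + - detℚ a c y) + detℚ a b y ≡ detℚ a b c
detℚ-barycentric-sum (a₁ , a₂) (b₁ , b₂) (c₁ , c₂) (y₁ , y₂) = QR.solve 8 (λ a₁ a₂ b₁ b₂ c₁ c₂ y₁ y₂ →
  (detℚᴾ b₁ b₂ c₁ c₂ y₁ y₂ :+ :- detℚᴾ a₁ a₂ c₁ c₂ y₁ y₂) :+ detℚᴾ a₁ a₂ b₁ b₂ y₁ y₂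
    := detℚᴾ a₁ a₂ b₁ b₂ c₁ c₂)
  refl a₁ a₂ b₁ b₂ c₁ c₂ y₁ y₂
  where open QR

p≤∣p∣ : ∀ p → p ≤ ∣ p ∣
p≤∣p∣ (mkℚ (+ n) d c) = ℚP.≤-refl
p≤∣p∣ p@(mkℚ -[1+ n ] d c) = ℚP.≤-trans (ℚP.<⇒≤ (ℚP.negative⁻¹ p)) (ℚP.0≤∣p∣ p)

-- |dx t₂ - dy t₁| ≤ (|dx| + |dy|) ε < E.
perturbation-pos : ∀ E dx dy t₁ t₂ ε (pK : 0ℚ < 1ℚ + (∣ dx ∣ + ∣ dy ∣)) → 0ℚ < E →
  ε ≤ E * recip (1ℚ + (∣ dx ∣ + ∣ dy ∣)) pK → ∣ t₁ ∣ < ε → ∣ t₂ ∣ < ε → 0ℚ < E - (dx * t₂ - dy * t₁)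
perturbation-pos E dx dy t₁ t₂ ε pK E>0 ε≤ t₁<ε t₂<ε = p<q⇒0<q-p (ℚP.≤-<-trans (p≤∣p∣ T) ∣T∣<E)
  where
  open ℚP.≤-Reasoning
  S = ∣ dx ∣ + ∣ dy ∣
  K = 1ℚ + S
  iK = recip K pK
  T = dx * t₂ - dy * t₁
  E/K>0 : 0ℚ < E * iK
  E/K>0 = *-pos E>0 (recip-pos K pK)
  ∣T∣<E : ∣ T ∣ < E
  ∣T∣<E = begin-strict
    ∣ T ∣                            ≤⟨ ℚP.∣p-q∣≤∣p∣+∣q∣ (dx * t₂) (dy * t₁) ⟩
    ∣ dx * t₂ ∣ + ∣ dy * t₁ ∣        ≡⟨ cong₂ _+_ (ℚP.∣p*q∣≡∣p∣*∣q∣ dx t₂) (ℚP.∣p*q∣≡∣p∣*∣q∣ dy t₁) ⟩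
    ∣ dx ∣ * ∣ t₂ ∣ + ∣ dy ∣ * ∣ t₁ ∣
      ≤⟨ ℚP.+-mono-≤ (ℚP.*-monoˡ-≤-nonNeg ∣ dx ∣ {{ℚP.∣-∣-nonNeg dx}} (ℚP.<⇒≤ t₂<ε))
                     (ℚP.*-monoˡ-≤-nonNeg ∣ dy ∣ {{ℚP.∣-∣-nonNeg dy}} (ℚP.<⇒≤ t₁<ε)) ⟩
    ∣ dx ∣ * ε + ∣ dy ∣ * ε          ≡⟨ ℚP.*-distribʳ-+ ε ∣ dx ∣ ∣ dy ∣ ⟨
    S * ε
      ≤⟨ ℚP.*-monoˡ-≤-nonNeg S {{ℚ.nonNegative (ℚP.+-mono-≤ (ℚP.0≤∣p∣ dx) (ℚP.0≤∣p∣ dy))}} ε≤ ⟩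
    S * (E * iK)                     <⟨ ℚP.*-monoˡ-<-pos (E * iK) {{ℚ.positive E/K>0}}
                                          (ℚP.<-≤-trans (ℚP.≤-<-trans (ℚP.≤-reflexive (sym (ℚP.+-identityˡ S)))
                                             (ℚP.+-monoˡ-< S (ℚP.positive⁻¹ 1ℚ))) ℚP.≤-refl) ⟩
    K * (E * iK)                     ≡⟨ trans (cong (K *_) (ℚP.*-comm E iK)) (*-recip-cancel K pK E) ⟩
    E                                ∎

minimum : ∀ {m} → (Fin (suc m) → ℚ) → ℚ
minimum {zero} f = f zero
minimum {suc m} f = f zero ⊓ minimum (λ i → f (suc i))

minimum-≤ : ∀ {m} (f : Fin (suc m) → ℚ) i → minimum f ≤ f i
minimum-≤ {zero} f zero = ℚP.≤-refl
minimum-≤ {suc m} f zero = ℚP.p⊓q≤p (f zero) _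
minimum-≤ {suc m} f (suc i) = ℚP.≤-trans (ℚP.p⊓q≤q (f zero) _) (minimum-≤ (λ i → f (suc i)) i)

minimum-pos : ∀ {m} (f : Fin (suc m) → ℚ) → (∀ i → 0ℚ < f i) → 0ℚ < minimum f
minimum-pos {zero} f h = h zero
minimum-pos {suc m} f h with ℚP.⊓-sel (f zero) (minimum (λ i → f (suc i)))
... | inj₁ e = subst (0ℚ <_) (sym e) (h zero)
... | inj₂ e = subst (0ℚ <_) (sym e) (minimum-pos (λ i → f (suc i)) (λ i → h (suc i)))

-- Vertices, interior and boundary of a polygon in convex position

BoundaryLatticePointsAreVertices : LatticePolytope → Set
BoundaryLatticePointsAreVertices P = (z : Lattice) → OnBoundary P (embed z) → IsVertex P (embed z)

module ConvexPolygon (m : ℕ) (w : ℕ → Lattice) (cv : ConvexPosition (suc (suc (suc m))) w) where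

  n : ℕ
  n = suc (suc (suc m))

  n≥3 : 3 ℕ.≤ n
  n≥3 = ℕ.s≤s (ℕ.s≤s (ℕ.s≤s ℕ.z≤n))

  V : Fin n → Lattice
  V j = w (toℕ j)

  polygon : LatticePolytope
  polygon = (n , V)

  E : ℕ → Pt
  E i = embed (w i)

  vertex-det : ℕ → ℕ → ℤ
  vertex-det j i = det (w (prev n j)) (w j) (w i) +ᶻ det (w j) (w (next n j)) (w i)

  vertex-det-self : ∀ j → vertex-det j j ≡ + 0
  vertex-det-self j = cong₂ _+ᶻ_ (det-abb (w (prev n j)) (w j)) (det-aba (w j) (w (next n j)))

  vertex-det-pos : ∀ {j i} → j ℕ.< n → i ℕ.< n → i ≢ j → + 0 <ᶻ vertex-det j i
  vertex-det-pos {j} {i} j<n i<n i≢j with i ℕ.≟ prev n j | i ℕ.≟ next n j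
  ... | yes refl | _ = ℤP.+-mono-≤-< (ℤP.≤-reflexive (sym (det-aba (w (prev n j)) (w j))))
                         (convex-cyclic {w = w} cv j<n (next-< j<n) i<n (cyclic-i-next-prev n≥3 j<n))
  ... | no _ | yes refl = ℤP.+-mono-<-≤ (convex-cyclic {w = w} cv (prev-< j<n) j<n i<n (cyclic-prev-i-next n≥3 j<n))
                         (ℤP.≤-reflexive (sym (det-abb (w j) (w (next n j)))))
  ... | no i≢p | no i≢s = ℤP.+-mono-<-≤ (convex-cyclic {w = w} cv (prev-< j<n) j<n i<n (cyclic-prev-i-x j<n i<n i≢j i≢p))
                         (ℤP.<⇒≤ (convex-cyclic {w = w} cv j<n (next-< j<n) i<n (cyclic-i-next-x j<n i<n i≢j i≢s)))

  vertex-functional : ℕ → Affine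
  vertex-functional j = det-functional (E (prev n j)) (E j) +ᵃ det-functional (E j) (E (next n j))

  ev-vertex-functional : ∀ j i → ev (vertex-functional j) (E i) ≡ ι (vertex-det j i)
  ev-vertex-functional j i = begin
    ev (vertex-functional j) (E i)
      ≡⟨ ev-+ᵃ (det-functional (E (prev n j)) (E j)) (det-functional (E j) (E (next n j))) (E i) ⟩
    ev (det-functional (E (prev n j)) (E j)) (E i) + ev (det-functional (E j) (E (next n j))) (E i)
      ≡⟨ cong₂ _+_ (ev-det-functional (E (prev n j)) (E j) (E i)) (ev-det-functional (E j) (E (next n j)) (E i)) ⟩
    detℚ (E (prev n j)) (E j) (E i) + detℚ (E j) (E (next n j)) (E i)
      ≡⟨ cong₂ _+_ (ι-det (w (prev n j)) (w j) (w i)) (ι-det (w j) (w (next n j)) (w i)) ⟨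
    ι (det (w (prev n j)) (w j) (w i)) + ι (det (w j) (w (next n j)) (w i))
      ≡⟨ ι-homo-+ (det (w (prev n j)) (w j) (w i)) (det (w j) (w (next n j)) (w i)) ⟨
    ι (vertex-det j i) ∎
    where open ≡-Reasoning

  exposes : ∀ j → Exposes V (vertex-functional (toℕ j)) j
  exposes j = trans (ev-vertex-functional (toℕ j) (toℕ j)) (cong ι (vertex-det-self (toℕ j))) ,
    λ i i≢j → subst (0ℚ <_) (sym (ev-vertex-functional (toℕ j) (toℕ i)))
                (ι-mono-< (vertex-det-pos (toℕ<n j) (toℕ<n i) (λ e → i≢j (toℕ-injective e))))

  vertex : ∀ j → IsVertex polygon (embed (V j))
  vertex j = exposes⇒vertex {n} {V} {vertex-functional (toℕ j)} {j} (exposes j)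

  embed-V-injective : ∀ i j → embed (V i) ≡ embed (V j) → i ≡ j
  embed-V-injective i j e with i ≟ᶠ j
  ... | yes i≡j = i≡j
  ... | no i≢j = ⊥-elim (ℚP.<-irrefl (sym (trans (cong (ev (vertex-functional (toℕ j))) e) (proj₁ (exposes j))))
                                      (proj₂ (exposes j) i i≢j))

  vertex-count : HasVertexCount polygon n
  vertex-count = (λ j → embed (V j)) , vertex , embed-V-injective , (λ _ → vertex⇒generator {n} {V})

  edge-det-nonNeg : ∀ {j i} → j ℕ.< n → i ℕ.< n → + 0 ≤ᶻ det (w j) (w (next n j)) (w i)
  edge-det-nonNeg {j} {i} j<n i<n with i ℕ.≟ j | i ℕ.≟ next n j
  ... | yes refl | _ = ℤP.≤-reflexive (sym (det-aba (w i) (w (next n i))))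
  ... | no _ | yes refl = ℤP.≤-reflexive (sym (det-abb (w j) (w (next n j))))
  ... | no i≢j | no i≢s = ℤP.<⇒≤ (convex-cyclic {w = w} cv j<n (next-< j<n) i<n (cyclic-i-next-x j<n i<n i≢j i≢s))

  edge-functional-nonNeg : ∀ {j} → j ℕ.< n → ∀ (i : Fin n) → 0ℚ ≤ ev (det-functional (E j) (E (next n j))) (embed (V i))
  edge-functional-nonNeg {j} j<n i =
    subst (0ℚ ≤_) (sym (trans (ev-det-functional (E j) (E (next n j)) (E (toℕ i))) (sym (ι-det (w j) (w (next n j)) (w (toℕ i))))))
      (ι-mono-≤ (edge-det-nonNeg j<n (toℕ<n i)))

  E∈polygon : ∀ {k} → k ℕ.< n → E k ∈conv polygon
  E∈polygon {k} k<n = subst (λ t → embed (w t) ∈conv polygon) (toℕ-fromℕ< k<n) (conic-generator {n} {V} (fromℕ< k<n))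

  InHalfplanes : Pt → Set
  InHalfplanes y = ∀ j → j ℕ.< n → 0ℚ ≤ detℚ (E j) (E (next n j)) y

  FanTriangle : Pt → Set
  FanTriangle y = Σ ℕ λ k → 1 ℕ.≤ k × suc k ℕ.< n × 0ℚ ≤ detℚ (E 0) (E k) y × detℚ (E 0) (E (suc k)) y ≤ 0ℚ

  -- Walk k up from 1 until det (w 0) (w (k+1)) y ≤ 0; at the last vertex the halfplane of the
  -- closing edge w (n-1) w 0 forces it.
  fan-triangle : ∀ y → InHalfplanes y → ∀ r k → k ℕ.+ suc r ≡ suc (suc m) → 1 ℕ.≤ k →
    0ℚ ≤ detℚ (E 0) (E k) y → FanTriangle y
  fan-triangle y h zero k e k≥1 Gk≥0 = k , k≥1 , subst (ℕ._< n) (sym 1+k≡) (ℕP.n<1+n (suc (suc m))) , Gk≥0 , Gk+1≤0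
    where
    1+k≡ : suc k ≡ suc (suc m)
    1+k≡ = trans (sym (ℕP.+-comm k 1)) e
    closing : 0ℚ ≤ detℚ (E (suc (suc m))) (E 0) y
    closing = subst (λ t → 0ℚ ≤ detℚ (E (suc (suc m))) (E t) y) (next-last {n} (ℕ.s≤s ℕ.z≤n)) (h (suc (suc m)) (ℕP.n<1+n (suc (suc m))))
    Gk+1≤0 : detℚ (E 0) (E (suc k)) y ≤ 0ℚ
    Gk+1≤0 = subst (λ t → detℚ (E 0) (E t) y ≤ 0ℚ) (sym 1+k≡)
      (ℚP.≤-trans (ℚP.≤-reflexive (sym (QR.solve 1 (λ x → :- (:- x) := x) refl (detℚ (E 0) (E (suc (suc m))) y))))
        (ℚP.neg-antimono-≤ (ℚP.≤-trans closing (ℚP.≤-reflexive (detℚ-swap₁₂ (E 0) (E (suc (suc m))) y)))))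
      where open QR
  fan-triangle y h (suc r) k e k≥1 Gk≥0 with detℚ (E 0) (E (suc k)) y ℚP.≤? 0ℚ
  ... | yes Gk+1≤0 = k , k≥1 , ℕ.s≤s (subst (k ℕ.<_) e (ℕP.m<m+n k (ℕ.s≤s ℕ.z≤n))) , Gk≥0 , Gk+1≤0
  ... | no Gk+1≰0 = fan-triangle y h r (suc k) (trans (sym (ℕP.+-suc k (suc r))) e) (ℕ.s≤s ℕ.z≤n) (ℚP.<⇒≤ (ℚP.≰⇒> Gk+1≰0))

  halfplanes⇒∈polygon : ∀ y → InHalfplanes y → y ∈conv polygon
  halfplanes⇒∈polygon y h with fan-triangle y h m 1 refl (ℕ.s≤s ℕ.z≤n)
    (subst (λ t → 0ℚ ≤ detℚ (E 0) (E t) y) (next-mid {n} {0} (ℕ.s≤s (ℕ.s≤s ℕ.z≤n))) (h 0 (ℕ.s≤s ℕ.z≤n)))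
  ... | k , k≥1 , k+1<n , Gk≥0 , Gk+1≤0 =
    combination₃ {polygon} (E∈polygon (ℕ.s≤s ℕ.z≤n)) (E∈polygon (ℕP.<-trans (ℕP.n<1+n k) k+1<n)) (E∈polygon k+1<n)
      (subst (λ t → 0ℚ ≤ detℚ (E k) (E t) y) (next-mid k+1<n) (h k (ℕP.<-trans (ℕP.n<1+n k) k+1<n)))
      (ℚP.neg-antimono-≤ Gk+1≤0) Gk≥0 D>0 (detℚ-barycentric (E 0) (E k) (E (suc k)) y)
    where
    D>0 : 0ℚ < (detℚ (E k) (E (suc k)) y + - detℚ (E 0) (E (suc k)) y) + detℚ (E 0) (E k) y
    D>0 = subst (0ℚ <_) (sym (trans (detℚ-barycentric-sum (E 0) (E k) (E (suc k)) y) (sym (ι-det (w 0) (w k) (w (suc k))))))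
            (ι-mono-< (cv 0 k (suc k) k≥1 (ℕP.n<1+n k) k+1<n))

  -- Each edge determinant tolerates a sup-norm perturbation of size E₀ / (1 + |dx| + |dy|).
  strictly-inside⇒RelInt : ∀ z → z ∈conv polygon → (∀ (j : Fin n) → 0ℚ < detℚ (E (toℕ j)) (E (next n (toℕ j))) z) →
    RelInt polygon z
  strictly-inside⇒RelInt z z∈ inside = z∈ , ε , ε>0 , λ y _ d → halfplanes⇒∈polygon y (λ j j<n → ℚP.<⇒≤ (perturbed y d j j<n))
    where
    E₀ dx dy : ℕ → ℚ
    E₀ j = detℚ (E j) (E (next n j)) z
    dx j = proj₁ (E (next n j)) - proj₁ (E j)
    dy j = proj₂ (E (next n j)) - proj₂ (E j)
    K>0 : ∀ j → 0ℚ < 1ℚ + (∣ dx j ∣ + ∣ dy j ∣)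
    K>0 j = ℚP.+-mono-<-≤ (ℚP.positive⁻¹ 1ℚ) (ℚP.+-mono-≤ (ℚP.0≤∣p∣ (dx j)) (ℚP.0≤∣p∣ (dy j)))
    εⱼ : ℕ → ℚ
    εⱼ j = E₀ j * recip (1ℚ + (∣ dx j ∣ + ∣ dy j ∣)) (K>0 j)
    ε = minimum (λ (j : Fin n) → εⱼ (toℕ j))
    ε>0 : 0ℚ < ε
    ε>0 = minimum-pos (λ (j : Fin n) → εⱼ (toℕ j)) (λ j → *-pos (inside j) (recip-pos _ (K>0 (toℕ j))))
    perturbed : ∀ y → dist∞< z y ε → ∀ j → j ℕ.< n → 0ℚ < detℚ (E j) (E (next n j)) y
    perturbed y (d₁ , d₂) j j<n = subst (0ℚ <_) (sym (detℚ-shift (E j) (E (next n j)) z y))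
      (perturbation-pos (E₀ j) (dx j) (dy j) _ _ ε (K>0 j)
        (subst (λ t → 0ℚ < E₀ t) (toℕ-fromℕ< j<n) (inside (fromℕ< j<n)))
        (subst (λ t → ε ≤ εⱼ t) (toℕ-fromℕ< j<n) (minimum-≤ (λ (j : Fin n) → εⱼ (toℕ j)) (fromℕ< j<n))) d₁ d₂)

  module _ (primitive-edges : ∀ j → j ℕ.< n → PrimitiveEdge (w j) (w (next n j))) where

    edge-point⇒vertex : ∀ z → embed z ∈conv polygon → (j : Fin n) →
      detℚ (E (toℕ j)) (E (next n (toℕ j))) (embed z) ≡ 0ℚ → IsVertex polygon (embed z)
    edge-point⇒vertex z z∈@(λs , nn , s1 , ez) j on-edge =
      [ (λ z≡A → subst (IsVertex polygon) (cong embed (sym z≡A)) (vertex j))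
      , (λ z≡B → subst (IsVertex polygon) (cong embed (sym (trans z≡B (sym (cong w j′≡))))) (vertex j′)) ]
      (primitive-edge-endpoints (w (toℕ j)) (w (next n (toℕ j))) z (λs j) (λs j′) (nn j) (nn j′) weights z≡
        (primitive-edges (toℕ j) (toℕ<n j)))
      where
      j<n = toℕ<n j
      j′ : Fin n
      j′ = fromℕ< (next-< j<n)
      j′≡ : toℕ j′ ≡ next n (toℕ j)
      j′≡ = toℕ-fromℕ< (next-< j<n)
      j′≢j : j′ ≢ j
      j′≢j e = next≢ (ℕP.<⇒≤ n≥3) j<n (trans (sym j′≡) (cong toℕ e))
      φ = det-functional (E (toℕ j)) (E (next n (toℕ j)))
      off-edge : ∀ i → i ≢ j → i ≢ j′ → λs i ≡ 0ℚ
      off-edge i i≢j i≢j′ = ev-zero⇒weight-zero {n} {V} φ (edge-functional-nonNeg j<n) z∈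
        (trans (ev-det-functional (E (toℕ j)) (E (next n (toℕ j))) (embed z)) on-edge) i
        (subst (0ℚ <_) (sym (trans (ev-det-functional (E (toℕ j)) (E (next n (toℕ j))) (E (toℕ i)))
                                   (sym (ι-det (w (toℕ j)) (w (next n (toℕ j))) (w (toℕ i))))))
          (ι-mono-< (convex-cyclic {w = w} cv j<n (next-< j<n) (toℕ<n i)
            (cyclic-i-next-x j<n (toℕ<n i) (λ e → i≢j (toℕ-injective e)) (λ e → i≢j′ (toℕ-injective (trans e (sym j′≡))))))))
      weights : λs j + λs j′ ≡ 1ℚ
      weights = trans (sym (sumℚ-pair λs j j′ j′≢j off-edge)) s1
      z≡ : embed z ≡ (λs j · E (toℕ j)) ⊕ (λs j′ · E (next n (toℕ j)))
      z≡ = trans (sym ez) (trans (sumPt-pair λs (λ i → embed (V i)) j j′ j′≢j off-edge)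
                                 (cong (λ t → (λs j · E (toℕ j)) ⊕ (λs j′ · E t)) j′≡))

    -- A point of the polygon off every edge line is strictly inside all edge halfplanes.
    boundary-point⇒vertex : BoundaryLatticePointsAreVertices polygon
    boundary-point⇒vertex z (z∈ , not-interior)
      with any? (λ (j : Fin n) → detℚ (E (toℕ j)) (E (next n (toℕ j))) (embed z) ℚP.≟ 0ℚ)
    ... | yes (j , on-edge) = edge-point⇒vertex z z∈ j on-edge
    ... | no off-edges = ⊥-elim (not-interior (strictly-inside⇒RelInt (embed z) z∈ λ j →
          ≤∧≢0⇒pos (subst (0ℚ ≤_) (ev-det-functional (E (toℕ j)) (E (next n (toℕ j))) (embed z))
                      (ev-nonNeg {n} {V} (det-functional (E (toℕ j)) (E (next n (toℕ j)))) (edge-functional-nonNeg (toℕ<n j)) z∈))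
                   (λ e → off-edges (j , e))))

-- Making all edges primitive, one vertex at a time

module PrimitiveEdges (P : LatticePolytope) {n : ℕ} (n≥3 : 3 ℕ.≤ n) where

  Inside : (ℕ → Lattice) → Set
  Inside w = ∀ j → j ℕ.< n → embed (w j) ∈conv P

  -- Replacing vertex k makes both edges at k primitive and leaves the other edges alone; so after
  -- vertices 0 … k-1 have been replaced, the edges leaving them are primitive, and so is the closing
  -- edge (n-1, 0) as soon as vertex 0 has been replaced.
  PrimitiveUpTo : ℕ → (ℕ → Lattice) → Set
  PrimitiveUpTo k w = ∀ j → j ℕ.< n → (j ℕ.< k ⊎ (1 ℕ.≤ k × j ≡ ℕ.pred n)) → PrimitiveEdge (w j) (w (next n j))

  State : ℕ → (ℕ → Lattice) → Set
  State k w = ConvexPosition n w × Inside w × PrimitiveUpTo k w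

  private
    earlier : ∀ j k → (j ℕ.< suc k ⊎ (1 ℕ.≤ suc k × j ≡ ℕ.pred n)) → j ≢ k → next n j ≢ k →
      j ℕ.< k ⊎ (1 ℕ.≤ k × j ≡ ℕ.pred n)
    earlier j k (inj₁ j<1+k) j≢k _ = inj₁ (<s∧≢⇒< j<1+k j≢k)
    earlier j zero (inj₂ (_ , j≡n-1)) _ next≢0 =
      ⊥-elim (next≢0 (trans (cong (next n) j≡n-1) (next-last (ℕP.≤-trans (ℕ.s≤s ℕ.z≤n) n≥3))))
    earlier j (suc k) (inj₂ (_ , j≡n-1)) _ _ = inj₂ (ℕ.s≤s ℕ.z≤n , j≡n-1)

    edge-cong : ∀ {a b c d} → a ≡ c → b ≡ d → PrimitiveEdge c d → PrimitiveEdge a b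
    edge-cong refl refl p = p

  replace-vertex : ∀ k → k ℕ.< n → (w : ℕ → Lattice) → State k w → Σ (ℕ → Lattice) (State (suc k))
  replace-vertex k k<n w (cv , inside , prim) with
    TriangleDescent.primitive-point (w (prev n k)) (w k) (w (next n k))
      (convex-cyclic {w = w} cv (prev-< k<n) k<n (next-< k<n) (cyclic-prev-i-next n≥3 k<n))
  ... | X , (α≥0 , β>0 , γ≥0) , primAX , primXC = w′ , preserves-convexity , inside′ , prim′
    where
    open ReplaceVertex {n} {w} cv n≥3 k<n X α≥0 β>0 γ≥0
    upd = []≔-updates w k X
    keep = []≔-minimal w k X
    inside′ : Inside w′
    inside′ j j<n = by-cases (j ℕ.≟ k)
      where
      by-cases : Dec (j ≡ k) → embed (w′ j) ∈conv P
      by-cases (yes refl) = subst (λ u → embed u ∈conv P) (sym upd)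
        (triangle-⊆ {P} (w (prev n k)) (w k) (w (next n k)) X (inside _ (prev-< k<n)) (inside k k<n) (inside _ (next-< k<n)) α≥0 β>0 γ≥0)
      by-cases (no j≢k) = subst (λ u → embed u ∈conv P) (sym (keep j j≢k)) (inside j j<n)
    prim′ : PrimitiveUpTo (suc k) w′
    prim′ j j<n h = by-cases (j ℕ.≟ k) (next n j ℕ.≟ k)
      where
      by-cases : Dec (j ≡ k) → Dec (next n j ≡ k) → PrimitiveEdge (w′ j) (w′ (next n j))
      by-cases (yes refl) _ = edge-cong upd (keep (next n k) (next≢ (ℕP.<⇒≤ n≥3) k<n)) primXC
      by-cases (no j≢k) (yes next≡k) =
        edge-cong (trans (keep j j≢k) (cong w (trans (sym (prev-next j<n)) (cong (prev n) next≡k))))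
                  (trans (cong w′ next≡k) upd) primAX
      by-cases (no j≢k) (no next≢k) = edge-cong (keep j j≢k) (keep (next n j) next≢k) (prim j j<n (earlier j k h j≢k next≢k))

  replace-all : ∀ r k → k ℕ.+ r ≡ n → (w : ℕ → Lattice) → State k w → Σ (ℕ → Lattice) (State n)
  replace-all zero k e w s = w , subst (λ t → State t w) (trans (sym (ℕP.+-identityʳ k)) e) s
  replace-all (suc r) k e w s =
    let w′ , s′ = replace-vertex k (subst (k ℕ.<_) e (ℕP.m<m+n k (ℕ.s≤s ℕ.z≤n))) w s
    in replace-all r (suc k) (trans (sym (ℕP.+-suc k r)) e) w′ s′

  primitive-polygon : (w : ℕ → Lattice) → ConvexPosition n w → Inside w →
    Σ (ℕ → Lattice) λ w′ → ConvexPosition n w′ × Inside w′ × (∀ j → j ℕ.< n → PrimitiveEdge (w′ j) (w′ (next n j)))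
  primitive-polygon w cv inside with replace-all n 0 refl w (cv , inside , λ { j _ (inj₁ ()) ; j _ (inj₂ (() , _)) })
  ... | w′ , cv′ , inside′ , prim = w′ , cv′ , inside′ , λ j j<n → prim j j<n (inj₁ j<n)

-- Three vertices are never collinear

vertex-on-segment : ∀ {P} (W X Y : Lattice) (α β : ℤ) → IsVertex P (embed W) → embed X ∈conv P → embed Y ∈conv P →
  + 0 <ᶻ α → + 0 <ᶻ β →
  (α +ᶻ β) *ᶻ proj₁ W ≡ α *ᶻ proj₁ X +ᶻ β *ᶻ proj₁ Y → (α +ᶻ β) *ᶻ proj₂ W ≡ α *ᶻ proj₂ X +ᶻ β *ᶻ proj₂ Y →
  Y ≡ W
vertex-on-segment {P} W X Y α β W-vertex X∈ Y∈ α>0 β>0 e₁ e₂ = embed-injective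
  (vertex-combination {P} {embed W} {embed X} {embed Y} {embed X} (ι α) (ι β) 0ℚ W-vertex X∈ Y∈ X∈
    (ℚP.<⇒≤ (ι-mono-< α>0)) (ι-mono-< β>0) ℚP.≤-refl (subst (0ℚ <_) (sym (ℚP.+-identityʳ (ι α))) (ι-mono-< α>0))
    (ι-combination₂ X Y W α β e₁ e₂))

private
  module CollinearIdentities where
    open ZR using (solve; _:+_; _:*_; _:-_; :-_; _:=_)

    -- Writing N = |x - p|² and t = (x - p)·(y - p), N (y - p) = t (x - p) - det p x y (x - p)^⊥.
    projection₁ : ∀ p₁ p₂ x₁ x₂ y₁ y₂ → let a₁ = x₁ -ᶻ p₁ ; a₂ = x₂ -ᶻ p₂ in
      (a₁ *ᶻ a₁ +ᶻ a₂ *ᶻ a₂) *ᶻ (y₁ -ᶻ p₁) ≡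
      (a₁ *ᶻ (y₁ -ᶻ p₁) +ᶻ a₂ *ᶻ (y₂ -ᶻ p₂)) *ᶻ a₁ -ᶻ a₂ *ᶻ det (p₁ , p₂) (x₁ , x₂) (y₁ , y₂)
    projection₁ = solve 6 (λ p₁ p₂ x₁ x₂ y₁ y₂ →
      ((x₁ :- p₁) :* (x₁ :- p₁) :+ (x₂ :- p₂) :* (x₂ :- p₂)) :* (y₁ :- p₁) :=
      ((x₁ :- p₁) :* (y₁ :- p₁) :+ (x₂ :- p₂) :* (y₂ :- p₂)) :* (x₁ :- p₁)
        :- (x₂ :- p₂) :* detᶻᴾ p₁ p₂ x₁ x₂ y₁ y₂) refl

    projection₂ : ∀ p₁ p₂ x₁ x₂ y₁ y₂ → let a₁ = x₁ -ᶻ p₁ ; a₂ = x₂ -ᶻ p₂ in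
      (a₁ *ᶻ a₁ +ᶻ a₂ *ᶻ a₂) *ᶻ (y₂ -ᶻ p₂) ≡
      (a₁ *ᶻ (y₁ -ᶻ p₁) +ᶻ a₂ *ᶻ (y₂ -ᶻ p₂)) *ᶻ a₂ +ᶻ a₁ *ᶻ det (p₁ , p₂) (x₁ , x₂) (y₁ , y₂)
    projection₂ = solve 6 (λ p₁ p₂ x₁ x₂ y₁ y₂ →
      ((x₁ :- p₁) :* (x₁ :- p₁) :+ (x₂ :- p₂) :* (x₂ :- p₂)) :* (y₂ :- p₂) :=
      ((x₁ :- p₁) :* (y₁ :- p₁) :+ (x₂ :- p₂) :* (y₂ :- p₂)) :* (x₂ :- p₂)
        :+ (x₁ :- p₁) :* detᶻᴾ p₁ p₂ x₁ x₂ y₁ y₂) refl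

    p-between : ∀ N t x p y → N *ᶻ (y -ᶻ p) ≡ t *ᶻ (x -ᶻ p) → (-ᶻ t +ᶻ N) *ᶻ p ≡ -ᶻ t *ᶻ x +ᶻ N *ᶻ y
    p-between N t x p y h = trans
      (solve 5 (λ N t x p y → (:- t :+ N) :* p := (:- t :* x :+ N :* y) :+ (t :* (x :- p) :- N :* (y :- p))) refl N t x p y)
      (trans (cong (λ r → (-ᶻ t *ᶻ x +ᶻ N *ᶻ y) +ᶻ (t *ᶻ (x -ᶻ p) -ᶻ r)) h)
        (solve 5 (λ N t x p y → (:- t :* x :+ N :* y) :+ (t :* (x :- p) :- t :* (x :- p)) := :- t :* x :+ N :* y) refl N t x p y))

    y-between : ∀ N t x p y → N *ᶻ (y -ᶻ p) ≡ t *ᶻ (x -ᶻ p) → ((N -ᶻ t) +ᶻ t) *ᶻ y ≡ (N -ᶻ t) *ᶻ p +ᶻ t *ᶻ x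
    y-between N t x p y h = trans
      (solve 5 (λ N t x p y → ((N :- t) :+ t) :* y := ((N :- t) :* p :+ t :* x) :+ (N :* (y :- p) :- t :* (x :- p))) refl N t x p y)
      (trans (cong (λ r → ((N -ᶻ t) *ᶻ p +ᶻ t *ᶻ x) +ᶻ (r -ᶻ t *ᶻ (x -ᶻ p))) h)
        (solve 5 (λ N t x p y → ((N :- t) :* p :+ t :* x) :+ (t :* (x :- p) :- t :* (x :- p)) := (N :- t) :* p :+ t :* x) refl N t x p y))

    x-between : ∀ N t x p y → N *ᶻ (y -ᶻ p) ≡ t *ᶻ (x -ᶻ p) → ((t -ᶻ N) +ᶻ N) *ᶻ x ≡ (t -ᶻ N) *ᶻ p +ᶻ N *ᶻ y
    x-between N t x p y h = trans
      (solve 5 (λ N t x p y → ((t :- N) :+ N) :* x := ((t :- N) :* p :+ N :* y) :+ (t :* (x :- p) :- N :* (y :- p))) refl N t x p y)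
      (trans (cong (λ r → ((t -ᶻ N) *ᶻ p +ᶻ N *ᶻ y) +ᶻ (t *ᶻ (x -ᶻ p) -ᶻ r)) h)
        (solve 5 (λ N t x p y → ((t :- N) :* p :+ N :* y) :+ (t :* (x :- p) :- t :* (x :- p)) := (t :- N) :* p :+ N :* y) refl N t x p y))

    y-at-x : ∀ N x p y → N *ᶻ (y -ᶻ p) ≡ N *ᶻ (x -ᶻ p) → N *ᶻ (y -ᶻ x) ≡ + 0
    y-at-x N x p y h = trans (solve 4 (λ N x p y → N :* (y :- x) := N :* (y :- p) :- N :* (x :- p)) refl N x p y)
      (trans (cong (_-ᶻ N *ᶻ (x -ᶻ p)) h) (ℤP.+-inverseʳ (N *ᶻ (x -ᶻ p))))

-- Collinearity gives N (y - p) = t (x - p); according to the position of t relative to 0 and N,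
-- one of p, y, x lies strictly between the other two.
vertices-not-collinear : ∀ {P} (p x y : Lattice) → IsVertex P (embed p) → IsVertex P (embed x) → IsVertex P (embed y) →
  x ≢ p → y ≢ p → x ≢ y → det p x y ≢ + 0
vertices-not-collinear {P} p@(p₁ , p₂) x@(x₁ , x₂) y@(y₁ , y₂) p-vertex x-vertex y-vertex x≢p y≢p x≢y collinear =
  by-position (ℤP.<-cmp t (+ 0)) (ℤP.<-cmp t N)
  where
  open CollinearIdentities
  N = (x₁ -ᶻ p₁) *ᶻ (x₁ -ᶻ p₁) +ᶻ (x₂ -ᶻ p₂) *ᶻ (x₂ -ᶻ p₂)
  t = (x₁ -ᶻ p₁) *ᶻ (y₁ -ᶻ p₁) +ᶻ (x₂ -ᶻ p₂) *ᶻ (y₂ -ᶻ p₂)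
  N>0 : + 0 <ᶻ N
  N>0 = squared-norm-pos p x x≢p
  h₁ : N *ᶻ (y₁ -ᶻ p₁) ≡ t *ᶻ (x₁ -ᶻ p₁)
  h₁ = trans (projection₁ p₁ p₂ x₁ x₂ y₁ y₂) (trans (cong (λ d → t *ᶻ (x₁ -ᶻ p₁) -ᶻ (x₂ -ᶻ p₂) *ᶻ d) collinear)
         (trans (cong (λ d → t *ᶻ (x₁ -ᶻ p₁) -ᶻ d) (ℤP.*-zeroʳ (x₂ -ᶻ p₂))) (ℤP.+-identityʳ (t *ᶻ (x₁ -ᶻ p₁)))))
  h₂ : N *ᶻ (y₂ -ᶻ p₂) ≡ t *ᶻ (x₂ -ᶻ p₂)
  h₂ = trans (projection₂ p₁ p₂ x₁ x₂ y₁ y₂) (trans (cong (λ d → t *ᶻ (x₂ -ᶻ p₂) +ᶻ (x₁ -ᶻ p₁) *ᶻ d) collinear)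
         (trans (cong (λ d → t *ᶻ (x₂ -ᶻ p₂) +ᶻ d) (ℤP.*-zeroʳ (x₁ -ᶻ p₁))) (ℤP.+-identityʳ (t *ᶻ (x₂ -ᶻ p₂)))))
  by-position : Tri (t <ᶻ + 0) (t ≡ + 0) (+ 0 <ᶻ t) → Tri (t <ᶻ N) (t ≡ N) (N <ᶻ t) → ⊥
  by-position (tri< t<0 _ _) _ =
    y≢p (vertex-on-segment {P} p x y (-ᶻ t) N p-vertex (proj₁ x-vertex) (proj₁ y-vertex) (ℤP.neg-mono-< t<0) N>0
           (p-between N t x₁ p₁ y₁ h₁) (p-between N t x₂ p₂ y₂ h₂))
  by-position (tri≈ _ t≡0 _) _ =
    y≢p (cong₂ _,_ (ℤP.i-j≡0⇒i≡j y₁ p₁ (*≡0⇒≡0ᶻ N>0 (trans h₁ (cong (_*ᶻ (x₁ -ᶻ p₁)) t≡0))))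
                   (ℤP.i-j≡0⇒i≡j y₂ p₂ (*≡0⇒≡0ᶻ N>0 (trans h₂ (cong (_*ᶻ (x₂ -ᶻ p₂)) t≡0)))))
  by-position (tri> _ _ t>0) (tri< t<N _ _) =
    x≢y (vertex-on-segment {P} y p x (N -ᶻ t) t y-vertex (proj₁ p-vertex) (proj₁ x-vertex) (i<j⇒0<j-i t<N) t>0
           (y-between N t x₁ p₁ y₁ h₁) (y-between N t x₂ p₂ y₂ h₂))
  by-position (tri> _ _ _) (tri≈ _ t≡N _) =
    x≢y (sym (cong₂ _,_ (ℤP.i-j≡0⇒i≡j y₁ x₁ (*≡0⇒≡0ᶻ N>0 (y-at-x N x₁ p₁ y₁ (trans h₁ (cong (_*ᶻ (x₁ -ᶻ p₁)) t≡N)))))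
                        (ℤP.i-j≡0⇒i≡j y₂ x₂ (*≡0⇒≡0ᶻ N>0 (y-at-x N x₂ p₂ y₂ (trans h₂ (cong (_*ᶻ (x₂ -ᶻ p₂)) t≡N)))))))
  by-position (tri> _ _ _) (tri> _ _ t>N) =
    x≢y (sym (vertex-on-segment {P} x p y (t -ᶻ N) N x-vertex (proj₁ p-vertex) (proj₁ y-vertex) (i<j⇒0<j-i t>N) N>0
                (x-between N t x₁ p₁ y₁ h₁) (x-between N t x₂ p₂ y₂ h₂)))

-- Sorting vertices by angle around the lexicographically smallest one

_<lex_ : Lattice → Lattice → Set
p <lex x = (proj₁ p <ᶻ proj₁ x) ⊎ (proj₁ p ≡ proj₁ x × proj₂ p <ᶻ proj₂ x)

_≤lex_ : Lattice → Lattice → Set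
a ≤lex b = a ≡ b ⊎ a <lex b

lex-compare : ∀ a b → a ≤lex b ⊎ b <lex a
lex-compare (a₁ , a₂) (b₁ , b₂) with ℤP.<-cmp a₁ b₁
... | tri< lt _ _ = inj₁ (inj₂ (inj₁ lt))
... | tri> _ _ gt = inj₂ (inj₁ gt)
... | tri≈ _ refl _ with ℤP.<-cmp a₂ b₂
...   | tri< lt _ _ = inj₁ (inj₂ (inj₂ (refl , lt)))
...   | tri≈ _ refl _ = inj₁ (inj₁ refl)
...   | tri> _ _ gt = inj₂ (inj₂ (refl , gt))

<lex-trans : ∀ {a b c} → a <lex b → b <lex c → a <lex c
<lex-trans (inj₁ l₁) (inj₁ l₂) = inj₁ (ℤP.<-trans l₁ l₂)
<lex-trans (inj₁ l₁) (inj₂ (e₂ , _)) = inj₁ (subst (_ <ᶻ_) e₂ l₁)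
<lex-trans (inj₂ (e₁ , _)) (inj₁ l₂) = inj₁ (subst (_<ᶻ _) (sym e₁) l₂)
<lex-trans (inj₂ (e₁ , l₁)) (inj₂ (e₂ , l₂)) = inj₂ (trans e₁ e₂ , ℤP.<-trans l₁ l₂)

≤lex-trans : ∀ {a b c} → a ≤lex b → b ≤lex c → a ≤lex c
≤lex-trans (inj₁ refl) h = h
≤lex-trans (inj₂ h₁) (inj₁ refl) = inj₂ h₁
≤lex-trans (inj₂ h₁) (inj₂ h₂) = inj₂ (<lex-trans h₁ h₂)

lex-minimum : ∀ {n} (f : Fin (suc n) → Lattice) → Σ (Fin (suc n)) λ i₀ → ∀ i → f i₀ ≤lex f i
lex-minimum {zero} f = zero , λ { zero → inj₁ refl }
lex-minimum {suc n} f with lex-minimum (λ i → f (suc i))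
... | i , min with lex-compare (f zero) (f (suc i))
...   | inj₁ le = zero , λ { zero → inj₁ refl ; (suc j) → ≤lex-trans le (min j) }
...   | inj₂ lt = suc i , λ { zero → inj₂ lt ; (suc j) → min j }

<lex⇒0≤Δ₁ : ∀ {p z} → p <lex z → + 0 ≤ᶻ proj₁ z -ᶻ proj₁ p
<lex⇒0≤Δ₁ (inj₁ lt) = ℤP.<⇒≤ (i<j⇒0<j-i lt)
<lex⇒0≤Δ₁ {p} (inj₂ (refl , _)) = ℤP.≤-reflexive (sym (ℤP.+-inverseʳ (proj₁ p)))

private
  module AngleIdentities where
    open ZR using (solve; _:+_; _:*_; _:-_; :-_; _:=_)

    three-angles : ∀ p₁ p₂ x₁ x₂ y₁ y₂ z₁ z₂ → (y₁ -ᶻ p₁) *ᶻ det (p₁ , p₂) (x₁ , x₂) (z₁ , z₂) ≡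
      (z₁ -ᶻ p₁) *ᶻ det (p₁ , p₂) (x₁ , x₂) (y₁ , y₂) +ᶻ (x₁ -ᶻ p₁) *ᶻ det (p₁ , p₂) (y₁ , y₂) (z₁ , z₂)
    three-angles = solve 8 (λ p₁ p₂ x₁ x₂ y₁ y₂ z₁ z₂ →
      (y₁ :- p₁) :* detᶻᴾ p₁ p₂ x₁ x₂ z₁ z₂ :=
      (z₁ :- p₁) :* detᶻᴾ p₁ p₂ x₁ x₂ y₁ y₂ :+ (x₁ :- p₁) :* detᶻᴾ p₁ p₂ y₁ y₂ z₁ z₂) refl

    vertical : ∀ p₁ p₂ y₂ z₁ z₂ → det (p₁ , p₂) (p₁ , y₂) (z₁ , z₂) ≡ -ᶻ ((y₂ -ᶻ p₂) *ᶻ (z₁ -ᶻ p₁))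
    vertical = solve 5 (λ p₁ p₂ y₂ z₁ z₂ → detᶻᴾ p₁ p₂ p₁ y₂ z₁ z₂ := :- ((y₂ :- p₂) :* (z₁ :- p₁))) refl

  -neg≯0 : ∀ {a} → + 0 ≤ᶻ a → ¬ (+ 0 <ᶻ -ᶻ a)
  -neg≯0 a≥0 lt = ℤP.<-irrefl refl (ℤP.<-≤-trans lt (ℤP.neg-mono-≤ a≥0))

-- Seen from p, all points lexicographically after p lie in a half-plane, where "counterclockwise
-- from" is transitive.
angular-trans : ∀ p x y z → p <lex x → p <lex y → p <lex z →
  + 0 <ᶻ det p x y → + 0 <ᶻ det p y z → + 0 <ᶻ det p x z
angular-trans (p₁ , p₂) (x₁ , x₂) (.p₁ , y₂) (z₁ , z₂) _ (inj₂ (refl , y₂>p₂)) p<z _ pyz>0 =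
  ⊥-elim (-neg≯0 (*-nonNegᶻ (ℤP.<⇒≤ (i<j⇒0<j-i y₂>p₂)) (<lex⇒0≤Δ₁ {p₁ , p₂} {z₁ , z₂} p<z))
                 (subst (+ 0 <ᶻ_) (AngleIdentities.vertical p₁ p₂ y₂ z₁ z₂) pyz>0))
angular-trans (p₁ , p₂) (.p₁ , x₂) (y₁ , y₂) _ (inj₂ (refl , x₂>p₂)) (inj₁ y₁>p₁) _ pxy>0 _ =
  ⊥-elim (-neg≯0 (*-nonNegᶻ (ℤP.<⇒≤ (i<j⇒0<j-i x₂>p₂)) (ℤP.<⇒≤ (i<j⇒0<j-i y₁>p₁)))
                 (subst (+ 0 <ᶻ_) (AngleIdentities.vertical p₁ p₂ x₂ y₁ y₂) pxy>0))
angular-trans (p₁ , p₂) (x₁ , x₂) (y₁ , y₂) (z₁ , z₂) (inj₁ x₁>p₁) (inj₁ y₁>p₁) p<z pxy>0 pyz>0 =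
  *-cancel-posᶻ (i<j⇒0<j-i y₁>p₁) (subst (+ 0 <ᶻ_) (sym (AngleIdentities.three-angles p₁ p₂ x₁ x₂ y₁ y₂ z₁ z₂))
    (ℤP.+-mono-≤-< (*-nonNegᶻ (<lex⇒0≤Δ₁ {p₁ , p₂} {z₁ , z₂} p<z) (ℤP.<⇒≤ pxy>0)) (*-posᶻ (i<j⇒0<j-i x₁>p₁) pyz>0)))

module AngularSort (p : Lattice) (Good : Lattice → Set)
  (not-collinear : ∀ x y → Good x → Good y → x ≢ y → det p x y ≢ + 0)
  (after-p : ∀ x → Good x → p <lex x) where

  _≺_ : Lattice → Lattice → Set
  x ≺ y = + 0 <ᶻ det p x y

  insert : Lattice → List Lattice → List Lattice
  insert x [] = x ∷ []
  insert x (y ∷ ys) with (+ 0) ℤP.<? det p x y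
  ... | yes _ = x ∷ y ∷ ys
  ... | no _ = y ∷ insert x ys

  sort : List Lattice → List Lattice
  sort [] = []
  sort (x ∷ xs) = insert x (sort xs)

  length-insert : ∀ x ys → length (insert x ys) ≡ suc (length ys)
  length-insert x [] = refl
  length-insert x (y ∷ ys) with (+ 0) ℤP.<? det p x y
  ... | yes _ = refl
  ... | no _ = cong suc (length-insert x ys)

  length-sort : ∀ xs → length (sort xs) ≡ length xs
  length-sort [] = refl
  length-sort (x ∷ xs) = trans (length-insert x (sort xs)) (cong suc (length-sort xs))

  All-insert : ∀ {Q : Lattice → Set} x ys → Q x → All Q ys → All Q (insert x ys)
  All-insert x [] qx [] = qx ∷ []
  All-insert x (y ∷ ys) qx (qy ∷ qys) with (+ 0) ℤP.<? det p x y
  ... | yes _ = qx ∷ qy ∷ qys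
  ... | no _ = qy ∷ All-insert x ys qx qys

  All-sort : ∀ {Q : Lattice → Set} xs → All Q xs → All Q (sort xs)
  All-sort [] [] = []
  All-sort (x ∷ xs) (qx ∷ qxs) = All-insert x (sort xs) qx (All-sort xs qxs)

  ⊀⇒≻ : ∀ {x y} → Good x → Good y → x ≢ y → ¬ x ≺ y → y ≺ x
  ⊀⇒≻ {x} {y} gx gy x≢y x⊀y = subst (+ 0 <ᶻ_) (sym (det-swap₂₃ p x y))
    (ℤP.neg-mono-< (ℤP.≤∧≢⇒< (ℤP.≮⇒≥ x⊀y) (not-collinear x y gx gy x≢y)))

  ≺-All-trans : ∀ {x y} ys → Good x → Good y → All Good ys → x ≺ y → All (y ≺_) ys → All (x ≺_) ys
  ≺-All-trans [] _ _ [] _ [] = []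
  ≺-All-trans {x} {y} (z ∷ zs) gx gy (gz ∷ gzs) x≺y (y≺z ∷ y≺zs) =
    angular-trans p x y z (after-p x gx) (after-p y gy) (after-p z gz) x≺y y≺z ∷ ≺-All-trans zs gx gy gzs x≺y y≺zs

  sorted-insert : ∀ x ys → Good x → All Good ys → All (x ≢_) ys → AllPairs _≺_ ys → AllPairs _≺_ (insert x ys)
  sorted-insert x [] _ [] [] [] = [] ∷ []
  sorted-insert x (y ∷ ys) gx (gy ∷ gys) (x≢y ∷ x≢ys) (y≺ys ∷ sorted) with (+ 0) ℤP.<? det p x y
  ... | yes x≺y = (x≺y ∷ ≺-All-trans ys gx gy gys x≺y y≺ys) ∷ y≺ys ∷ sorted
  ... | no x⊀y = All-insert x ys (⊀⇒≻ gx gy x≢y x⊀y) y≺ys ∷ sorted-insert x ys gx gys x≢ys sorted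

  sorted-sort : ∀ xs → All Good xs → AllPairs _≢_ xs → AllPairs _≺_ (sort xs)
  sorted-sort [] [] [] = []
  sorted-sort (x ∷ xs) (gx ∷ gxs) (x≢xs ∷ distinct) =
    sorted-insert x (sort xs) gx (All-sort xs gxs) (All-sort xs x≢xs) (sorted-sort xs gxs distinct)

nth : List Lattice → ℕ → Lattice
nth [] _ = (+ 0 , + 0)
nth (x ∷ xs) zero = x
nth (x ∷ xs) (suc k) = nth xs k

All-nth : ∀ {Q : Lattice → Set} {xs} → All Q xs → ∀ j → j ℕ.< length xs → Q (nth xs j)
All-nth (q ∷ _) zero _ = q
All-nth (_ ∷ qs) (suc j) (ℕ.s≤s j<) = All-nth qs j j<

AllPairs-nth : ∀ {R : Lattice → Lattice → Set} {xs} → AllPairs R xs → ∀ a b → a ℕ.< b → b ℕ.< length xs → R (nth xs a) (nth xs b)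
AllPairs-nth {R} {x ∷ xs} (h ∷ _) zero (suc b) _ (ℕ.s≤s b<) = All-nth {Q = R x} h b b<
AllPairs-nth {R} {x ∷ xs} (_ ∷ hs) (suc a) (suc b) (ℕ.s≤s a<b) (ℕ.s≤s b<) = AllPairs-nth hs a b a<b b<

module VertexList {k} {v : Fin k → Lattice} {n} (hvc : HasVertexCount (k , v) n) where

  U : Fin n → Lattice
  U i = v (proj₁ (vertex⇒generator {k} {v} (proj₁ (proj₂ hvc) i)))

  embed-U : ∀ i → embed (U i) ≡ proj₁ hvc i
  embed-U i = proj₂ (vertex⇒generator {k} {v} (proj₁ (proj₂ hvc) i))

  U-vertex : ∀ i → IsVertex (k , v) (embed (U i))
  U-vertex i = subst (IsVertex (k , v)) (sym (embed-U i)) (proj₁ (proj₂ hvc) i)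

  U-injective : ∀ i j → U i ≡ U j → i ≡ j
  U-injective i j e = proj₁ (proj₂ (proj₂ hvc)) i j (trans (sym (embed-U i)) (trans (cong embed e) (embed-U j)))

-- Listing the other vertices by angle around the lexicographically smallest vertex p gives a
-- polygon in convex position.
module InitialPolygon {k} {v : Fin k → Lattice} {m} (hvc : HasVertexCount (k , v) (suc (suc (suc m)))) where
  open VertexList {k} {v} hvc

  n : ℕ
  n = suc (suc (suc m))

  n≥3 : 3 ℕ.≤ n
  n≥3 = ℕ.s≤s (ℕ.s≤s (ℕ.s≤s ℕ.z≤n))

  P : LatticePolytope
  P = (k , v)

  i₀ : Fin n
  i₀ = proj₁ (lex-minimum U)

  p : Lattice
  p = U i₀

  Good : Lattice → Set
  Good x = IsVertex P (embed x) × p <lex x × x ≢ p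

  others : Fin (suc (suc m)) → Lattice
  others i = U (punchIn i₀ i)

  others-good : ∀ i → Good (others i)
  others-good i = good (proj₂ (lex-minimum U) (punchIn i₀ i))
    where
    x≢p : others i ≢ p
    x≢p x≡p = punchInᵢ≢i i₀ i (U-injective (punchIn i₀ i) i₀ x≡p)
    good : p ≤lex others i → Good (others i)
    good (inj₁ p≡x) = ⊥-elim (x≢p (sym p≡x))
    good (inj₂ p<x) = U-vertex (punchIn i₀ i) , p<x , x≢p

  open AngularSort p Good
    (λ x y gx gy → vertices-not-collinear {P} p x y (U-vertex i₀) (proj₁ gx) (proj₁ gy) (proj₂ (proj₂ gx)) (proj₂ (proj₂ gy)))
    (λ x gx → proj₁ (proj₂ gx))

  S : List Lattice
  S = sort (tabulate others)

  |S| : length S ≡ suc (suc m)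
  |S| = trans (length-sort (tabulate others)) (length-tabulate others)

  S-good : All Good S
  S-good = All-sort (tabulate others) (All.tabulate⁺ others-good)

  S-sorted : AllPairs _≺_ S
  S-sorted = sorted-sort (tabulate others) (All.tabulate⁺ others-good)
    (AllPairs.tabulate⁺ (λ {i} {j} i≢j e → i≢j (punchIn-injective i₀ i j (U-injective (punchIn i₀ i) (punchIn i₀ j) e))))

  w : ℕ → Lattice
  w zero = p
  w (suc j) = nth S j

  S-good-at : ∀ j → j ℕ.< suc (suc m) → Good (nth S j)
  S-good-at j j< = All-nth S-good j (subst (j ℕ.<_) (sym |S|) j<)

  inside : ∀ j → j ℕ.< n → embed (w j) ∈conv P
  inside zero _ = proj₁ (U-vertex i₀)
  inside (suc j) (ℕ.s≤s j<) = proj₁ (proj₁ (S-good-at j j<))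

  -- Otherwise nth S b would lie in the triangle p, nth S a, nth S c with positive weight on
  -- nth S a, and being a vertex it would equal nth S a.
  sorted-counterclockwise : ∀ a b c → a ℕ.< b → b ℕ.< c → c ℕ.< suc (suc m) → + 0 <ᶻ det (nth S a) (nth S b) (nth S c)
  sorted-counterclockwise a b c a<b b<c c< = by-cases ((+ 0) ℤP.<? det Xa Xb Xc)
    where
    Xa = nth S a
    Xb = nth S b
    Xc = nth S c
    b< = ℕP.<-trans b<c c<
    a< = ℕP.<-trans a<b b<
    β>0 : + 0 <ᶻ det p Xb Xc
    β>0 = AllPairs-nth S-sorted b c b<c (subst (c ℕ.<_) (sym |S|) c<)
    γ>0 : + 0 <ᶻ det p Xa Xb
    γ>0 = AllPairs-nth S-sorted a b a<b (subst (b ℕ.<_) (sym |S|) b<)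
    Xa≡Xb : + 0 ≤ᶻ det Xb Xa Xc → Xa ≡ Xb
    Xa≡Xb α≥0 = embed-injective (vertex-combination {P} {embed Xb} {embed p} {embed Xa} {embed Xc}
      (ι (det Xb Xa Xc)) (ι (det p Xb Xc)) (ι (det p Xa Xb))
      (proj₁ (S-good-at b b<)) (proj₁ (U-vertex i₀)) (proj₁ (proj₁ (S-good-at a a<))) (proj₁ (proj₁ (S-good-at c c<)))
      (ι-mono-≤ α≥0) (ι-mono-< β>0) (ι-mono-≤ (ℤP.<⇒≤ γ>0)) (ℚP.+-mono-≤-< (ι-mono-≤ α≥0) (ι-mono-< γ>0))
      (ι-barycentric p Xa Xc Xb))
    by-cases : Dec (+ 0 <ᶻ det Xa Xb Xc) → + 0 <ᶻ det Xa Xb Xc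
    by-cases (yes ccw) = ccw
    by-cases (no not-ccw) = ⊥-elim (ℤP.<-irrefl (sym (trans (cong (λ t → det p t Xb) (Xa≡Xb α≥0)) (det-abb p Xb))) γ>0)
      where
      α≥0 : + 0 ≤ᶻ det Xb Xa Xc
      α≥0 = subst (+ 0 ≤ᶻ_) (sym (det-swap₁₂ Xa Xb Xc)) (ℤP.neg-mono-≤ (ℤP.≮⇒≥ not-ccw))

  convex : ConvexPosition n w
  convex zero zero _ () _ _
  convex zero (suc b) (suc c) _ (ℕ.s≤s b<c) (ℕ.s≤s c<) = AllPairs-nth S-sorted b c b<c (subst (c ℕ.<_) (sym |S|) c<)
  convex (suc a) (suc b) (suc c) (ℕ.s≤s a<b) (ℕ.s≤s b<c) (ℕ.s≤s c<) = sorted-counterclockwise a b c a<b b<c c<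

dot-functional : Lattice → Lattice → Affine
dot-functional (o₁ , o₂) (e₁ , e₂) = (- (ι e₁ * ι o₁ + ι e₂ * ι o₂) , ι e₁ , ι e₂)

ev-dot-functional : ∀ o e y →
  ev (dot-functional o e) (embed y) ≡ ι (proj₁ e *ᶻ (proj₁ y -ᶻ proj₁ o) +ᶻ proj₂ e *ᶻ (proj₂ y -ᶻ proj₂ o))
ev-dot-functional (o₁ , o₂) (e₁ , e₂) (y₁ , y₂) = sym (begin
  ι (e₁ *ᶻ (y₁ -ᶻ o₁) +ᶻ e₂ *ᶻ (y₂ -ᶻ o₂))          ≡⟨ ι-homo-+ (e₁ *ᶻ (y₁ -ᶻ o₁)) (e₂ *ᶻ (y₂ -ᶻ o₂)) ⟩
  ι (e₁ *ᶻ (y₁ -ᶻ o₁)) + ι (e₂ *ᶻ (y₂ -ᶻ o₂))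
    ≡⟨ cong₂ _+_ (trans (ι-homo-* e₁ (y₁ -ᶻ o₁)) (cong (ι e₁ *_) (ι-homo-sub y₁ o₁)))
                 (trans (ι-homo-* e₂ (y₂ -ᶻ o₂)) (cong (ι e₂ *_) (ι-homo-sub y₂ o₂))) ⟩
  ι e₁ * (ι y₁ - ι o₁) + ι e₂ * (ι y₂ - ι o₂)
    ≡⟨ QR.solve 6 (λ e₁ e₂ o₁ o₂ y₁ y₂ → e₁ :* (y₁ :- o₁) :+ e₂ :* (y₂ :- o₂) :=
         :- (e₁ :* o₁ :+ e₂ :* o₂) :+ (e₁ :* y₁ :+ e₂ :* y₂)) refl (ι e₁) (ι e₂) (ι o₁) (ι o₂) (ι y₁) (ι y₂) ⟩
  - (ι e₁ * ι o₁ + ι e₂ * ι o₂) + (ι e₁ * ι y₁ + ι e₂ * ι y₂) ∎)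
  where
  open ≡-Reasoning
  open QR using (_:+_; _:*_; _:-_; :-_; _:=_)

dot-functional-separates : ∀ (a b : Lattice) → b ≢ a →
  (ev (dot-functional a (b ⊖ a)) (embed a) ≡ 0ℚ) × (0ℚ < ev (dot-functional a (b ⊖ a)) (embed b))
dot-functional-separates a@(a₁ , a₂) b@(b₁ , b₂) b≢a =
  trans (ev-dot-functional a (b ⊖ a) a)
    (cong ι (ZR.solve 4 (λ d₁ d₂ a₁ a₂ → d₁ :* (a₁ :- a₁) :+ d₂ :* (a₂ :- a₂) := con (+ 0))
               refl (b₁ -ᶻ a₁) (b₂ -ᶻ a₂) a₁ a₂)) ,
  subst (0ℚ <_) (sym (ev-dot-functional a (b ⊖ a) b)) (ι-mono-< (squared-norm-pos a b b≢a))
  where open ZR using (_:+_; _:*_; _:-_; _:=_; con)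

module Point (u : Lattice) where

  point : LatticePolytope
  point = (1 , const u)

  point-hull : ∀ x → x ∈conv point → x ≡ embed u
  point-hull x (λs , _ , s1 , refl) = begin
    (λs zero · embed u) ⊕ origin  ≡⟨ ⊕-identityʳ _ ⟩
    λs zero · embed u             ≡⟨ cong (_· embed u) (trans (sym (ℚP.+-identityʳ (λs zero))) s1) ⟩
    1ℚ · embed u                  ≡⟨ ·-identityˡ (embed u) ⟩
    embed u                       ∎
    where open ≡-Reasoning

  point-vertex : IsVertex point (embed u)
  point-vertex = conic-generator {1} {const u} zero , λ p _ _ p∈ _ _ _ _ → point-hull p p∈

  point-count : HasVertexCount point 1
  point-count = const (embed u) , const point-vertex , (λ { zero zero _ → refl }) ,
    λ x x-vertex → zero , sym (point-hull x (proj₁ x-vertex))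

  point-boundary : BoundaryLatticePointsAreVertices point
  point-boundary z (z∈ , _) = subst (IsVertex point) (sym (point-hull (embed z) z∈)) point-vertex

module Segment (A X : Lattice) (X≢A : X ≢ A) (primitive-AX : PrimitiveEdge A X) where

  ends : Fin 2 → Lattice
  ends zero = A
  ends (suc zero) = X

  segment : LatticePolytope
  segment = (2 , ends)

  A-vertex : IsVertex segment (embed A)
  A-vertex = exposes⇒vertex {2} {ends} {dot-functional A (X ⊖ A)} {zero}
    (proj₁ (dot-functional-separates A X X≢A) ,
     λ { zero 0≢0 → ⊥-elim (0≢0 refl) ; (suc zero) _ → proj₂ (dot-functional-separates A X X≢A) })

  X-vertex : IsVertex segment (embed X)
  X-vertex = exposes⇒vertex {2} {ends} {dot-functional X (A ⊖ X)} {suc zero}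
    (proj₁ (dot-functional-separates X A (λ e → X≢A (sym e))) ,
     λ { zero _ → proj₂ (dot-functional-separates X A (λ e → X≢A (sym e))) ; (suc zero) 1≢1 → ⊥-elim (1≢1 refl) })

  ends-vertex : ∀ i → IsVertex segment (embed (ends i))
  ends-vertex zero = A-vertex
  ends-vertex (suc zero) = X-vertex

  ends-injective : ∀ i j → embed (ends i) ≡ embed (ends j) → i ≡ j
  ends-injective zero zero _ = refl
  ends-injective zero (suc zero) e = ⊥-elim (X≢A (sym (embed-injective e)))
  ends-injective (suc zero) zero e = ⊥-elim (X≢A (embed-injective e))
  ends-injective (suc zero) (suc zero) _ = refl

  segment-count : HasVertexCount segment 2
  segment-count = (λ i → embed (ends i)) , ends-vertex , ends-injective , λ _ → vertex⇒generator {2} {ends}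

  segment-boundary : BoundaryLatticePointsAreVertices segment
  segment-boundary z ((λs , nn , s1 , ez) , _) = endpoint-vertex
    (primitive-edge-endpoints A X z (λs zero) (λs (suc zero)) (nn zero) (nn (suc zero))
      (trans (cong (λ t → λs zero + t) (sym (ℚP.+-identityʳ (λs (suc zero))))) s1)
      (trans (sym ez) (cong ((λs zero · embed A) ⊕_) (⊕-identityʳ (λs (suc zero) · embed X))))
      primitive-AX)
    where
    endpoint-vertex : z ≡ A ⊎ z ≡ X → IsVertex segment (embed z)
    endpoint-vertex (inj₁ refl) = A-vertex
    endpoint-vertex (inj₂ refl) = X-vertex

ReducedSubpolytope : LatticePolytope → ℕ → Set
ReducedSubpolytope P n = Σ LatticePolytope λ P′ → (P′ ⊆P P) × HasVertexCount P′ n × BoundaryLatticePointsAreVertices P′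

no-vertices : ∀ P → ReducedSubpolytope P 0
no-vertices P = ∅ , (λ x x∈ → ⊥-elim (∅-empty x x∈)) ,
  ((λ ()) , (λ ()) , (λ ()) , λ x x-vertex → ⊥-elim (∅-empty x (proj₁ x-vertex))) ,
  λ z z∈∂ → ⊥-elim (∅-empty (embed z) (proj₁ z∈∂))
  where
  ∅ : LatticePolytope
  ∅ = (0 , λ ())
  ∅-empty : ∀ x → ¬ (x ∈conv ∅)
  ∅-empty x (_ , _ , () , _)

one-vertex : ∀ {k v} → HasVertexCount (k , v) 1 → ReducedSubpolytope (k , v) 1
one-vertex {k} {v} hvc = point , ⊆ , point-count , point-boundary
  where
  open VertexList {k} {v} hvc
  open Point (U zero)
  ⊆ : point ⊆P (k , v)
  ⊆ x x∈ = subst (_∈conv (k , v)) (sym (point-hull x x∈)) (proj₁ (U-vertex zero))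

-- Shorten the segment between the two vertices A and B to its first lattice step A + (B - A) / gcd.
two-vertices : ∀ {k v} → HasVertexCount (k , v) 2 → ReducedSubpolytope (k , v) 2
two-vertices {k} {v} hvc = shorten (primitive-decomposition (B ⊖ A) (λ B-A≡0 → B≢A (⊖≡0⇒≡ B A B-A≡0)))
  where
  open VertexList {k} {v} hvc
  A = U zero
  B = U (suc zero)
  B≢A : B ≢ A
  B≢A e with U-injective (suc zero) zero e
  ... | ()
  shorten : (Σ ℕ λ g → Σ Lattice λ q → Primitive q × B ⊖ A ≡ scale (suc g) q) → ReducedSubpolytope (k , v) 2
  shorten (g , q , q-primitive , B-A≡) = segment , hull-⊆P {k , v} ends ends∈ , segment-count , segment-boundary
    where
    open ZR using (solve; _:+_; _:*_; _:-_; _:=_; con)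
    X = A ⊞ q
    X-A≡q : X ⊖ A ≡ q
    X-A≡q = cong₂ _,_ (solve 2 (λ a q → (a :+ q) :- a := q) refl (proj₁ A) (proj₁ q))
                      (solve 2 (λ a q → (a :+ q) :- a := q) refl (proj₂ A) (proj₂ q))
    X≢A : X ≢ A
    X≢A X≡A = ¬primitive-0 (subst Primitive (trans (sym X-A≡q) (trans (cong (_⊖ A) X≡A) (⊖-self A))) q-primitive)
    open Segment A X X≢A (subst Primitive (sym X-A≡q) q-primitive)
    B≡ : B ≡ A ⊞ scale (suc g) q
    B≡ = trans (⊖-⊞ A B) (cong (A ⊞_) B-A≡)
    first-step : ∀ a q → (+ g +ᶻ + 1) *ᶻ (a +ᶻ q) ≡ + g *ᶻ a +ᶻ + 1 *ᶻ (a +ᶻ q *ᶻ + suc g)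
    first-step a q = solve 3 (λ a q h → (h :+ con (+ 1)) :* (a :+ q) := h :* a :+ con (+ 1) :* (a :+ q :* (con (+ 1) :+ h)))
                       refl a q (+ g)
    X∈ : embed X ∈conv (k , v)
    X∈ = segment-point∈ {k , v} A B X (+ g) (+ 1) (proj₁ (U-vertex zero)) (proj₁ (U-vertex (suc zero)))
      (ℤ.+≤+ ℕ.z≤n) (ℤ.+<+ (ℕ.s≤s ℕ.z≤n))
      (trans (first-step (proj₁ A) (proj₁ q)) (cong (λ b → + g *ᶻ proj₁ A +ᶻ + 1 *ᶻ proj₁ b) (sym B≡)))
      (trans (first-step (proj₂ A) (proj₂ q)) (cong (λ b → + g *ᶻ proj₂ A +ᶻ + 1 *ᶻ proj₂ b) (sym B≡)))
    ends∈ : ∀ j → embed (ends j) ∈conv (k , v)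
    ends∈ zero = proj₁ (U-vertex zero)
    ends∈ (suc zero) = X∈

many-vertices : ∀ {k v m} → HasVertexCount (k , v) (suc (suc (suc m))) → ReducedSubpolytope (k , v) (suc (suc (suc m)))
many-vertices {k} {v} {m} hvc =
  let w′ , convex′ , inside′ , edges = PrimitiveEdges.primitive-polygon (k , v) n≥3 w convex inside
      open ConvexPolygon m w′ convex′
  in polygon , hull-⊆P {k , v} V (λ j → inside′ (toℕ j) (toℕ<n j)) , vertex-count , boundary-point⇒vertex edges
  where open InitialPolygon {k} {v} {m} hvc

mainTheorem13 : (P : LatticePolytope) (n : ℕ) → HasVertexCount P n →
    Σ LatticePolytope λ P' →
      (P' ⊆P P) × HasVertexCount P' n ×
      ((z : Lattice) → OnBoundary P' (embed z) → IsVertex P' (embed z))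
mainTheorem13 P zero _ = no-vertices P
mainTheorem13 (k , v) (suc zero) hvc = one-vertex {k} {v} hvc
mainTheorem13 (k , v) (suc (suc zero)) hvc = two-vertices {k} {v} hvc
mainTheorem13 (k , v) (suc (suc (suc m))) hvc = many-vertices {k} {v} hvc
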